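{- For every $i\in\{1,\dots,b\}$, the set $T$ returned by the bucketing-based algorithm with input $\vec B=(B_1,\dots,B_b)$ satisfies \[\mathbb{E}[|T\cap B_i|]\ \ge\ \frac14\sum_{e\in B_i\cap\mathrm{OPT}} p_{e,f(B_{i-1})}\ \ge\ \frac14\sum_{e\in B_i\cap\mathrm{OPT}} p_{e,f(B_i)},\] regardless of the order in which the elements of $N\setminus S$ are revealed.
   Context: $M=(N,\mathcal{I})$ is a matroid with rank function $r$ and span $\mathrm{span}(A)=\{e\in N: r(A\cup\{e\})=r(A)\}$. Weights $w:N\to\mathbb{R}_{>0}$ are pairwise distinct and $\mathrm{OPT}$ is the unique maximum-weight independent set of $M$. Values $\tilde\rho\ge 1$, $W>0$ are given. Let $h=\lceil 3+\log_2\tilde{\rho}\rceil$ and $C_i=\{e\in N: w(e)\in (W/2^{h-i+1}, W/2^{h-i}]\}$ for $i\in\{1,\dots,h\}$; $C_{\ge i}=\bigcup_{j=i}^h C_j$. A bucketing $\vec B=(B_1,\dots,B_b)$ partitions the weight classes into buckets $B_i=\bigcup_{j=f(B_i)}^{\ell(B_i)}C_j$ with $f(B_1)=1$, $\ell(B_i)+1=f(B_{i+1})$, $\ell(B_b)=h$; $B_j=\varnothing$ for $j>b$, $f(B_j)=\ell(B_j)=0$ for $j\le 0$, $B_{\ge i}=\bigcup_{j\ge i}B_j$. For $S\subseteq N$ let $M_1=(M/(S\cap B_{\geq 2}))|_{B_1}$ and $M_i=(M/(S\cap B_{\geq i+1}))|_{B_i\cap \mathrm{span}(S\cap B_{\geq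 i-1})}$ for $i\in\{2,\dots,h\}$ (contraction then restriction), with ground set $N_i$ and independent sets $\mathcal{I}_i$. $H_{\mathrm{odd}}$, $H_{\mathrm{even}}$ are the odd, resp. even, indices in $\{1,\dots,h\}$. Bucketing-based algorithm with input $\vec B$: let $S$ contain each element of $N$ independently with probability $1/2$ (observed, never selected); let $H=H_{\mathrm{odd}}$ with probability $1/2$ and $H=H_{\mathrm{even}}$ otherwise; set $T_i=\varnothing$ for $i\in H$; then for every $e\in N\setminus S$ as it is revealed (in an arbitrary order, possibly depending on $S$), letting $i$ be such that $e\in B_i$: if $i\in H$, $e\in N_i$ and $T_i\cup\{e\}\in\mathcal{I}_i$, add $e$ to $T_i$. Return $T=\bigcup_{i\in H}T_i$. For $e\in N$, $i\in\{1,\dots,h\}$: $p_{e,i}=\Pr[e\in\mathrm{span}(S\cap C_{\ge i})\mid e\notin S]$ with $S$ a random set containing each element independently with probability $1/2$; and $p_{e,0}=1$.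
   Formalization: The weights $w$ and the values $\tilde\rho$ and $W$ are rational rather than real. -}

module Defs where

open import Data.Bool using (Bool; true; false; _∧_; _∨_; not; if_then_else_)
open import Data.Nat as ℕ using (ℕ; zero; suc; _∸_; _^_)
import Data.Nat.Properties as ℕP
open import Data.Integer using (+_)
open import Data.Rational as ℚ using (ℚ; 0ℚ; 1ℚ)
import Data.Rational.Properties as ℚP
open import Data.Fin using (Fin)
open import Data.Fin.Subset as Sub using (Subset; ⁅_⁆; _∪_; _∩_; ∣_∣; ⊥)
open import Data.Vec using (Vec; []; _∷_; lookup)
open import Data.List as L using (List; []; _∷_; _++_; map; foldl; foldr; filter; allFin; upTo)
open import Data.List.Relation.Unary.Unique.Propositional using (Unique)
import Data.List.Membership.Propositional as LM
open import Data.Product using (_×_; Σ; ∃; _,_)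
open import Function.Bundles using (_⇔_)
open import Relation.Nullary using (¬_)
open import Relation.Nullary.Decidable using (⌊_⌋)
open import Relation.Binary.PropositionalEquality using (_≡_; _≢_)

allSubsets : (n : ℕ) → List (Subset n)
allSubsets zero    = [] ∷ []
allSubsets (suc n) = map (false ∷_) (allSubsets n) ++ map (true ∷_) (allSubsets n)

_∈ᵇ_ : ∀ {n} → Fin n → Subset n → Bool
e ∈ᵇ A = lookup A e

_⊆ᵇ_ : ∀ {n} → Subset n → Subset n → Bool
[]      ⊆ᵇ []      = true
(x ∷ A) ⊆ᵇ (y ∷ B) = (not x ∨ y) ∧ (A ⊆ᵇ B)

setOf : ∀ {n} → (Fin n → Bool) → Subset n
setOf {zero}  P = []
setOf {suc n} P = P Fin.zero ∷ setOf (λ e → P (Fin.suc e))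
  where import Data.Fin as Fin

count : ∀ {A : Set} → (A → Bool) → List A → ℕ
count P []       = 0
count P (x ∷ xs) = if P x then suc (count P xs) else count P xs

sumℚ : List ℚ → ℚ
sumℚ = foldr ℚ._+_ 0ℚ

maxℕ : List ℕ → ℕ
maxℕ = foldr ℕ._⊔_ 0

anyᵇ : ∀ {A : Set} → (A → Bool) → List A → Bool
anyᵇ P = foldr (λ x b → P x ∨ b) false

-- the list [a, a+1, ..., c] (empty if c < a)
range : ℕ → ℕ → List ℕ
range a c = map (a ℕ.+_) (upTo (suc c ∸ a))

record Matroid (n : ℕ) : Set where
  field
    indep       : Subset n → Bool
    indep-empty : indep ⊥ ≡ true
    indep-down  : ∀ A B → A ⊆ᵇ B ≡ true → indep B ≡ true → indep A ≡ true
    indep-exch  : ∀ A B → indep A ≡ true → indep B ≡ true → ∣ A ∣ ℕ.< ∣ B ∣ →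
                  Σ (Fin n) λ e → (e ∈ᵇ B ≡ true) × (e ∈ᵇ A ≡ false) × (indep (A ∪ ⁅ e ⁆) ≡ true)

module _ {n : ℕ} (M : Matroid n) where
  open Matroid M

  rank : Subset n → ℕ
  rank A = maxℕ (map (λ I → if (I ⊆ᵇ A) ∧ indep I then ∣ I ∣ else 0) (allSubsets n))

  inSpan : Subset n → Fin n → Bool
  inSpan A e = ⌊ rank (A ∪ ⁅ e ⁆) ℕP.≟ rank A ⌋

  span : Subset n → Subset n
  span A = setOf (inSpan A)

  -- independence in (M / X)|_Y : I ⊆ Y, I ∩ X = ∅, and r_M(I ∪ X) − r_M(X) = |I|
  -- (i.e. r_{M/X}(I) = |I| with r_{M/X}(A) = r_M(A ∪ X) − r_M(X))
  indepContrRestr : (X Y : Subset n) → Subset n → Bool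
  indepContrRestr X Y I =
    (I ⊆ᵇ Y) ∧ ⌊ ∣ I ∩ X ∣ ℕP.≟ 0 ⌋ ∧ ⌊ rank (I ∪ X) ℕP.≟ ∣ I ∣ ℕ.+ rank X ⌋

weight : ∀ {n} → (Fin n → ℚ) → Subset n → ℚ
weight {n} w A = sumℚ (map (λ e → if e ∈ᵇ A then w e else 0ℚ) (allFin n))

IsUniqueMaxWeightBasis : ∀ {n} → Matroid n → (Fin n → ℚ) → Subset n → Set
IsUniqueMaxWeightBasis {n} M w O =
  (Matroid.indep M O ≡ true) ×
  (∀ I → Matroid.indep M I ≡ true → I ≢ O → weight w I ℚ.< weight w O)

divPow2 : ℚ → ℕ → ℚ
divPow2 W k = W ℚ.* ((+ 1 ℚ./ (2 ^ k)) {{ℕP.m^n≢0 2 k}})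

-- h = ⌈3 + log₂ ρ̃⌉ : the least natural h with 3 + log₂ ρ̃ ≤ h, i.e. 8·ρ̃ ≤ 2^h
IsCeilLog : ℚ → ℕ → Set
IsCeilLog ρ h = ((+ 8 ℚ./ 1) ℚ.* ρ ℚ.≤ (+ (2 ^ h) ℚ./ 1)) ×
                (∀ k → (+ 8 ℚ./ 1) ℚ.* ρ ℚ.≤ (+ (2 ^ k) ℚ./ 1) → h ℕ.≤ k)

module Classes {n : ℕ} (w : Fin n → ℚ) (W : ℚ) (h : ℕ) where

  inC : ℕ → Fin n → Bool
  inC i e = ⌊ 1 ℕP.≤? i ⌋ ∧ ⌊ i ℕP.≤? h ⌋ ∧
            ⌊ divPow2 W (suc (h ∸ i)) ℚP.<? w e ⌋ ∧ ⌊ w e ℚP.≤? divPow2 W (h ∸ i) ⌋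

  inC≥ : ℕ → Fin n → Bool
  inC≥ i e = anyᵇ (λ j → inC j e) (range i h)

  C≥ : ℕ → Subset n
  C≥ i = setOf (inC≥ i)

-- A bucketing of the classes 1..h into b buckets, given by the last class
-- indices ℓ(B_1) < ℓ(B_2) < ... < ℓ(B_b) = h (with the convention ℓ(B_0) = 0);
-- then f(B_j) = ℓ(B_{j-1}) + 1 and B_j = C_{f(B_j)} ∪ ... ∪ C_{ℓ(B_j)}.
record Bucketing (h : ℕ) : Set where
  field
    b      : ℕ
    ℓ      : ℕ → ℕ
    ℓ-zero : ℓ 0 ≡ 0
    ℓ-last : ℓ b ≡ h
    ℓ-mono : ∀ j → j ℕ.< b → ℓ j ℕ.< ℓ (suc j)

module Algorithm {n : ℕ} (M : Matroid n) (w : Fin n → ℚ) (W : ℚ) (h : ℕ)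
                 (B : Bucketing h) where
  open Classes w W h public
  open Bucketing B

  -- f(B_j): for 1 ≤ j ≤ b it is ℓ(B_{j-1}) + 1; for j ≤ 0 it is 0
  fB : ℕ → ℕ
  fB zero    = 0
  fB (suc j) = suc (ℓ j)

  inB : ℕ → Fin n → Bool
  inB j e = ⌊ 1 ℕP.≤? j ⌋ ∧ ⌊ j ℕP.≤? b ⌋ ∧ anyᵇ (λ k → inC k e) (range (fB j) (ℓ j))

  Bset : ℕ → Subset n
  Bset j = setOf (inB j)

  inB≥ : ℕ → Fin n → Bool
  inB≥ j e = anyᵇ (λ k → inB k e) (range j b)

  B≥ : ℕ → Subset n
  B≥ j = setOf (inB≥ j)

  -- the index i with e ∈ B_i (0 if e lies in no bucket)
  bucketOf : Fin n → ℕ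
  bucketOf e = foldr (λ j r → if inB j e then j else r) 0 (range 1 b)

  groundM : Subset n → ℕ → Subset n
  groundM S zero          = Bset 0
  groundM S (suc zero)    = Bset 1
  groundM S i@(suc (suc k)) = Bset i ∩ span M (S ∩ B≥ (suc k))

  indepM : Subset n → ℕ → Subset n → Bool
  indepM S i = indepContrRestr M (S ∩ B≥ (suc i)) (groundM S i)

  inH : Bool → ℕ → Bool
  inH odd i = ⌊ 1 ℕP.≤? i ⌋ ∧ ⌊ i ℕP.≤? h ⌋ ∧ (if odd then isOdd i else not (isOdd i))
    where
    isOdd : ℕ → Bool
    isOdd zero          = false
    isOdd (suc zero)    = true
    isOdd (suc (suc m)) = isOdd m

  -- processing one revealed element e; T is the union of the T_i, so T_i = T ∩ B_i
  step : Subset n → Bool → Subset n → Fin n → Subset n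
  step S odd T e =
    let i = bucketOf e in
    if inH odd i ∧ (e ∈ᵇ groundM S i) ∧ indepM S i ((T ∩ Bset i) ∪ ⁅ e ⁆)
    then T ∪ ⁅ e ⁆ else T

  run : Subset n → Bool → List (Fin n) → Subset n
  run S odd order = foldl (step S odd) ⊥ order

  IsRevealOrder : (Subset n → List (Fin n)) → Set
  IsRevealOrder ord = ∀ S → Unique (ord S) × (∀ e → (e LM.∈ ord S) ⇔ (e ∈ᵇ S ≡ false))

  -- E[|T ∩ B_i|] : S uniform over the 2^n subsets, H uniform over {H_odd, H_even}
  expectedTB : (Subset n → List (Fin n)) → ℕ → ℚ
  expectedTB ord i =
    (+ (foldr ℕ._+_ 0 (map (λ S → ∣ run S true (ord S) ∩ Bset i ∣ ℕ.+ ∣ run S false (ord S) ∩ Bset i ∣)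
                   (allSubsets n)))
     ℚ./ (2 ^ suc n)) {{ℕP.m^n≢0 2 (suc n)}}

  -- p_{e,k} = Pr[e ∈ span(S ∩ C_{≥ k}) | e ∉ S]  (k ≥ 1),  p_{e,0} = 1.
  -- Pr[A | e ∉ S] = Pr[A ∧ e ∉ S] / Pr[e ∉ S] = Pr[A ∧ e ∉ S] / (1/2).
  p : Fin n → ℕ → ℚ
  p e zero    = 1ℚ
  p e (suc k) =
    (+ (2 ℕ.* count (λ S → not (e ∈ᵇ S) ∧ inSpan M (S ∩ C≥ (suc k)) e) (allSubsets n))
     ℚ./ (2 ^ n)) {{ℕP.m^n≢0 2 n}}

  sumP : Subset n → ℕ → ℕ → ℚ
  sumP OPT i k = sumℚ (map (λ e → if inB i e ∧ (e ∈ᵇ OPT) then p e k else 0ℚ) (allFin n))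

{-# OPTIONS --safe #-}

-- Fix i and a sample S, and let J_S be the set of e ∈ B_i ∩ OPT with e ∉ S and
-- e ∈ span(S ∩ C_{≥ f(B_{i-1})}) (no span condition when i = 1).  Since C_{≥ f(B_{i-1})} ⊆ B_{≥ i-1},
-- J_S lies in the ground set N_i of M_i.  Every element of B_{≥ i+1} outweighs every element of B_i,
-- and OPT meets every upper set Y of the weight order in a basis of Y, so J_S ∪ (OPT ∩ Y) is
-- independent and J_S is independent in the contraction M / (S ∩ B_{≥ i+1}).  If i ∈ H, the online
-- greedy set T_i is a maximal independent set of M_i among the revealed elements, so the
-- augmentation property of contractions gives |J_S| ≤ |T ∩ B_i|; hence
-- |J_S| ≤ |T_odd ∩ B_i| + |T_even ∩ B_i| for the two choices of H.  Double counting,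
-- Σ_S |J_S| = Σ_{e ∈ B_i ∩ OPT} #{S : e ∉ S, e spanned} = 2^(n-1) Σ_e p_{e,f(B_{i-1})}, and averaging
-- over the 2^(n+1) choices of (S, H) gives the first inequality.  The second holds because
-- p_{e,k} decreases in k: C_{≥ k} shrinks as k grows and span is monotone.

module Submission where

open import Defs
open import Data.Bool using (Bool; true; false; _∧_; _∨_; not; if_then_else_)
open import Data.Bool.Properties using (¬-not; not-¬)
open import Data.Nat as ℕ using (ℕ; zero; suc; _+_; _∸_; _^_; z≤n; s≤s)
open import Data.Nat.Properties
open import Data.Rational as ℚ using (ℚ; 0ℚ; 1ℚ)
import Data.Rational.Properties as ℚP
open import Data.Fin using (Fin; zero; suc)
open import Data.Fin.Subset using (Subset; _∈_; _∉_; _⊆_; _∪_; _∩_; _─_; ⁅_⁆; ∣_∣; ⊥)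
open import Data.Fin.Subset.Properties
open import Data.Vec.Base using ([]; _∷_; here; there)
open import Data.Vec.Properties using ([]=⇒lookup; lookup⇒[]=)
open import Data.List as List using (List; []; _∷_; _++_; map; foldr; foldl; allFin)
open import Data.Nat.ListAction using (sum)
open import Data.List.Membership.Propositional using () renaming (_∈_ to _∈ˡ_)
open import Data.List.Membership.Propositional.Properties
  using (∈-map⁺; ∈-map⁻; ∈-++⁺ˡ; ∈-++⁺ʳ; foldr-selective)
open import Data.List.Relation.Unary.Any using (here; there)
open import Data.Product using (∃; _×_; _,_; proj₁; proj₂; uncurry)
open import Data.Empty using (⊥-elim)
open import Data.Sum using (_⊎_; inj₁; inj₂; [_,_]′)
open import Function using (_∘_)
open import Relation.Binary.PropositionalEquality
  using (_≡_; _≢_; refl; sym; trans; cong; cong₂; subst; subst₂; module ≡-Reasoning)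
open import Relation.Nullary using (¬_; yes; no; Dec; contradiction)
open import Relation.Nullary.Decidable using (⌊_⌋; decidable-stable; _×-dec_; ¬?)
open import Data.Fin.Properties using (any?)

⌊⌋-sound : ∀ {P : Set} (P? : Dec P) → ⌊ P? ⌋ ≡ true → P
⌊⌋-sound (yes p) _ = p

⌊⌋-complete : ∀ {P : Set} (P? : Dec P) → P → ⌊ P? ⌋ ≡ true
⌊⌋-complete (yes _) _ = refl
⌊⌋-complete (no ¬p) p = contradiction p ¬p

∧≡true⁻ : ∀ a {b} → a ∧ b ≡ true → a ≡ true × b ≡ true
∧≡true⁻ true b≡true = refl , b≡true

∧≡true⁺ : ∀ {a b} → a ≡ true → b ≡ true → a ∧ b ≡ true
∧≡true⁺ refl b≡true = b≡true

if-cases : ∀ {A : Set} b {x y : A} →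
           b ≡ true × (if b then x else y) ≡ x ⊎ b ≡ false × (if b then x else y) ≡ y
if-cases true  = inj₁ (refl , refl)
if-cases false = inj₂ (refl , refl)

if-≤ : ∀ b {x y} → x ℚ.≤ y → (if b then x else 0ℚ) ℚ.≤ (if b then y else 0ℚ)
if-≤ true  x≤y = x≤y
if-≤ false _   = ℚP.≤-refl

module Subsets where
  open import Data.Nat using (_≤_; _<_)

  private
    variable
      n : ℕ
      x : Fin n
      p q r : Subset n

  ∈ᵇ⇒∈ : x ∈ᵇ p ≡ true → x ∈ p
  ∈ᵇ⇒∈ {x = x} {p} = lookup⇒[]= x p

  ∈⇒∈ᵇ : x ∈ p → x ∈ᵇ p ≡ true
  ∈⇒∈ᵇ = []=⇒lookup

  ∉⇒∈ᵇ≡false : x ∉ p → x ∈ᵇ p ≡ false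
  ∉⇒∈ᵇ≡false x∉p = ¬-not (x∉p ∘ ∈ᵇ⇒∈)

  ∈ᵇ≡false⇒∉ : x ∈ᵇ p ≡ false → x ∉ p
  ∈ᵇ≡false⇒∉ x∉p x∈p = not-¬ (∈⇒∈ᵇ x∈p) x∉p

  lookup-setOf : ∀ (P : Fin n → Bool) x → x ∈ᵇ setOf P ≡ P x
  lookup-setOf P zero    = refl
  lookup-setOf P (suc x) = lookup-setOf (P ∘ suc) x

  ∈-setOf⁺ : ∀ {P : Fin n → Bool} → P x ≡ true → x ∈ setOf P
  ∈-setOf⁺ {x = x} {P} = ∈ᵇ⇒∈ ∘ trans (lookup-setOf P x)

  ∈-setOf⁻ : ∀ {P : Fin n → Bool} → x ∈ setOf P → P x ≡ true
  ∈-setOf⁻ {x = x} {P} = trans (sym (lookup-setOf P x)) ∘ ∈⇒∈ᵇ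

  ⊆ᵇ⇒⊆ : p ⊆ᵇ q ≡ true → p ⊆ q
  ⊆ᵇ⇒⊆ {p = true ∷ p} {true ∷ q}  _ here      = here
  ⊆ᵇ⇒⊆ {p = true ∷ p} {false ∷ q} () here
  ⊆ᵇ⇒⊆ {p = s ∷ p}    {t ∷ q}     h (there i) = there (⊆ᵇ⇒⊆ (proj₂ (∧≡true⁻ (not s ∨ t) h)) i)

  ⊆⇒⊆ᵇ : p ⊆ q → p ⊆ᵇ q ≡ true
  ⊆⇒⊆ᵇ {p = []}        {[]}    _   = refl
  ⊆⇒⊆ᵇ {p = false ∷ p} {_ ∷ q} p⊆q = ⊆⇒⊆ᵇ (drop-∷-⊆ p⊆q)
  ⊆⇒⊆ᵇ {p = true ∷ p}  {_ ∷ q} p⊆q with p⊆q here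
  ... | here = ⊆⇒⊆ᵇ (drop-∷-⊆ p⊆q)

  ∪-lub : p ⊆ r → q ⊆ r → p ∪ q ⊆ r
  ∪-lub {p = p} {q = q} p⊆r q⊆r = [ p⊆r , q⊆r ]′ ∘ x∈p∪q⁻ p q

  ∩-glb : r ⊆ p → r ⊆ q → r ⊆ p ∩ q
  ∩-glb r⊆p r⊆q x∈r = x∈p∩q⁺ (r⊆p x∈r , r⊆q x∈r)

  ∩-monoʳ-⊆ : ∀ (p : Subset n) → q ⊆ r → p ∩ q ⊆ p ∩ r
  ∩-monoʳ-⊆ {q = q} p q⊆r = ∩-glb (p∩q⊆p p q) (⊆-trans (p∩q⊆q p q) q⊆r)

  Disjoint : Subset n → Subset n → Set
  Disjoint p q = ∀ {x} → x ∈ p → x ∉ q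

  ∣p∪q∣+∣p∩q∣≡∣p∣+∣q∣ : ∀ (p q : Subset n) → ∣ p ∪ q ∣ + ∣ p ∩ q ∣ ≡ ∣ p ∣ + ∣ q ∣
  ∣p∪q∣+∣p∩q∣≡∣p∣+∣q∣ []          []          = refl
  ∣p∪q∣+∣p∩q∣≡∣p∣+∣q∣ (false ∷ p) (false ∷ q) = ∣p∪q∣+∣p∩q∣≡∣p∣+∣q∣ p q
  ∣p∪q∣+∣p∩q∣≡∣p∣+∣q∣ (false ∷ p) (true ∷ q)  =
    trans (cong suc (∣p∪q∣+∣p∩q∣≡∣p∣+∣q∣ p q)) (sym (+-suc _ _))
  ∣p∪q∣+∣p∩q∣≡∣p∣+∣q∣ (true ∷ p)  (false ∷ q) = cong suc (∣p∪q∣+∣p∩q∣≡∣p∣+∣q∣ p q)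
  ∣p∪q∣+∣p∩q∣≡∣p∣+∣q∣ (true ∷ p)  (true ∷ q)  =
    cong suc (trans (+-suc _ _) (trans (cong suc (∣p∪q∣+∣p∩q∣≡∣p∣+∣q∣ p q)) (sym (+-suc _ _))))

  ∣p∪q∣≤∣p∣+∣q∣ : ∀ (p q : Subset n) → ∣ p ∪ q ∣ ≤ ∣ p ∣ + ∣ q ∣
  ∣p∪q∣≤∣p∣+∣q∣ p q = ≤-trans (m≤m+n _ _) (≤-reflexive (∣p∪q∣+∣p∩q∣≡∣p∣+∣q∣ p q))

  p─q#q : ∀ (p q : Subset n) → Disjoint (p ─ q) q
  p─q#q (_ ∷ p) (false ∷ q) here           ()
  p─q#q (_ ∷ p) (true ∷ q)  ()             here
  p─q#q (_ ∷ p) (_ ∷ q)     (there x∈p─q) (there x∈q) = p─q#q p q x∈p─q x∈q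

  x∈p∪⁅x⁆ : ∀ (p : Subset n) x → x ∈ p ∪ ⁅ x ⁆
  x∈p∪⁅x⁆ p x = q⊆p∪q p ⁅ x ⁆ (x∈⁅x⁆ x)

  x∈p⇒⁅x⁆⊆p : x ∈ p → ⁅ x ⁆ ⊆ p
  x∈p⇒⁅x⁆⊆p {x = x} {p} x∈p y∈⁅x⁆ = subst (_∈ p) (sym (x∈⁅y⁆⇒x≡y x y∈⁅x⁆)) x∈p

  Disjoint-∪⁅x⁆ : Disjoint p q → x ∉ q → Disjoint (p ∪ ⁅ x ⁆) q
  Disjoint-∪⁅x⁆ {p = p} {x = x} p#q x∉q y∈p∪x with x∈p∪q⁻ p ⁅ x ⁆ y∈p∪x
  ... | inj₁ y∈p   = p#q y∈p
  ... | inj₂ y∈⁅x⁆ = subst (_∉ _) (sym (x∈⁅y⁆⇒x≡y x y∈⁅x⁆)) x∉q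

  Disjoint⇒p∩q≡⊥ : Disjoint p q → p ∩ q ≡ ⊥
  Disjoint⇒p∩q≡⊥ {p = p} {q} p#q = Empty-unique λ (x , x∈p∩q) → uncurry p#q (x∈p∩q⁻ p q x∈p∩q)

  ∣p∩q∣≡0⇒Disjoint : ∣ p ∩ q ∣ ≡ 0 → Disjoint p q
  ∣p∩q∣≡0⇒Disjoint {p = p} {q} ∣p∩q∣≡0 {x} x∈p x∈q
    with subst (1 ≤_) ∣p∩q∣≡0
           (subst (_≤ ∣ p ∩ q ∣) (∣⁅x⁆∣≡1 x) (p⊆q⇒∣p∣≤∣q∣ (x∈p⇒⁅x⁆⊆p (x∈p∩q⁺ (x∈p , x∈q)))))
  ... | ()

  ∣p∪q∣≡∣p∣+∣q∣ : Disjoint p q → ∣ p ∪ q ∣ ≡ ∣ p ∣ + ∣ q ∣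
  ∣p∪q∣≡∣p∣+∣q∣ {n} {p} {q} p#q = begin
    ∣ p ∪ q ∣               ≡⟨ +-identityʳ _ ⟨
    ∣ p ∪ q ∣ + 0           ≡⟨ cong (∣ p ∪ q ∣ +_) (∣⊥∣≡0 n) ⟨
    ∣ p ∪ q ∣ + ∣ ⊥ {n} ∣   ≡⟨ cong (λ s → ∣ p ∪ q ∣ + ∣ s ∣) (Disjoint⇒p∩q≡⊥ p#q) ⟨
    ∣ p ∪ q ∣ + ∣ p ∩ q ∣   ≡⟨ ∣p∪q∣+∣p∩q∣≡∣p∣+∣q∣ p q ⟩
    ∣ p ∣ + ∣ q ∣           ∎
    where open ≡-Reasoning

  ∣p∪⁅x⁆∣≡1+∣p∣ : x ∉ p → ∣ p ∪ ⁅ x ⁆ ∣ ≡ suc ∣ p ∣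
  ∣p∪⁅x⁆∣≡1+∣p∣ {x = x} {p} x∉p = begin
    ∣ p ∪ ⁅ x ⁆ ∣     ≡⟨ ∣p∪q∣≡∣p∣+∣q∣ p#x ⟩
    ∣ p ∣ + ∣ ⁅ x ⁆ ∣ ≡⟨ cong (∣ p ∣ +_) (∣⁅x⁆∣≡1 x) ⟩
    ∣ p ∣ + 1         ≡⟨ +-comm _ 1 ⟩
    suc ∣ p ∣         ∎
    where
    open ≡-Reasoning
    p#x : Disjoint p ⁅ x ⁆
    p#x y∈p y∈⁅x⁆ = x∉p (subst (_∈ p) (x∈⁅y⁆⇒x≡y x y∈⁅x⁆) y∈p)

  [p∪⁅x⁆]∩q⊆p∩q∪⁅x⁆ : ∀ (p q : Subset n) x → (p ∪ ⁅ x ⁆) ∩ q ⊆ p ∩ q ∪ ⁅ x ⁆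
  [p∪⁅x⁆]∩q⊆p∩q∪⁅x⁆ p q x y∈ with x∈p∩q⁻ (p ∪ ⁅ x ⁆) q y∈
  ... | y∈p∪x , y∈q with x∈p∪q⁻ p ⁅ x ⁆ y∈p∪x
  ...   | inj₁ y∈p = p⊆p∪q ⁅ x ⁆ (x∈p∩q⁺ (y∈p , y∈q))
  ...   | inj₂ y∈x = q⊆p∪q (p ∩ q) ⁅ x ⁆ y∈x

  x∉q⇒[p∪⁅x⁆]∩q⊆p∩q : ∀ (p q : Subset n) {x} → x ∉ q → (p ∪ ⁅ x ⁆) ∩ q ⊆ p ∩ q
  x∉q⇒[p∪⁅x⁆]∩q⊆p∩q p q {x} x∉q y∈ with x∈p∩q⁻ (p ∪ ⁅ x ⁆) q y∈
  ... | y∈p∪x , y∈q with x∈p∪q⁻ p ⁅ x ⁆ y∈p∪x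
  ...   | inj₁ y∈p = x∈p∩q⁺ (y∈p , y∈q)
  ...   | inj₂ y∈x = contradiction (subst (_∈ q) (x∈⁅y⁆⇒x≡y x y∈x) y∈q) x∉q

  p⊆r⇒p∩q∪⁅x⁆⊆r∩q∪⁅x⁆ : ∀ {p r} (q : Subset n) x → p ⊆ r → p ∩ q ∪ ⁅ x ⁆ ⊆ r ∩ q ∪ ⁅ x ⁆
  p⊆r⇒p∩q∪⁅x⁆⊆r∩q∪⁅x⁆ {p = p} {r} q x p⊆r =
    ∪-lub (⊆-trans (∩-glb (⊆-trans (p∩q⊆p p q) p⊆r) (p∩q⊆q p q)) (p⊆p∪q ⁅ x ⁆))
          (q⊆p∪q (r ∩ q) ⁅ x ⁆)

  p⊆q∧∣q∣≤∣p∣⇒p≡q : p ⊆ q → ∣ q ∣ ≤ ∣ p ∣ → p ≡ q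
  p⊆q∧∣q∣≤∣p∣⇒p≡q {p = p} {q} p⊆q ∣q∣≤∣p∣ = ⊆-antisym p⊆q q⊆p
    where
    q⊆p : q ⊆ p
    q⊆p {x} x∈q = decidable-stable (x ∈? p) λ x∉p →
      ≤⇒≯ ∣q∣≤∣p∣ (p⊂q⇒∣p∣<∣q∣ (p⊆q , x , x∈q , x∉p))

  ∣p∣<∣q∣⇒∃∈q∖p : ∣ p ∣ < ∣ q ∣ → ∃ λ x → x ∈ q × x ∉ p
  ∣p∣<∣q∣⇒∃∈q∖p {p = p} {q} ∣p∣<∣q∣ with any? (λ x → x ∈? q ×-dec ¬? (x ∈? p))
  ... | yes x∈q∖p = x∈q∖p
  ... | no  none  = contradiction (p⊆q⇒∣p∣≤∣q∣ q⊆p) (<⇒≱ ∣p∣<∣q∣)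
    where
    q⊆p : q ⊆ p
    q⊆p {x} x∈q = decidable-stable (x ∈? p) λ x∉p → none (x , x∈q , x∉p)

  allSubsets-complete : ∀ (p : Subset n) → p ∈ˡ allSubsets n
  allSubsets-complete []                = here refl
  allSubsets-complete {suc n} (false ∷ p) = ∈-++⁺ˡ (∈-map⁺ (false ∷_) (allSubsets-complete p))
  allSubsets-complete {suc n} (true ∷ p)  =
    ∈-++⁺ʳ (map (false ∷_) (allSubsets n)) (∈-map⁺ (true ∷_) (allSubsets-complete p))

module Lists where
  open import Data.Nat using (_≤_; _<_; _*_)
  open import Data.List using (upTo)
  open import Data.List.Membership.Propositional.Properties using (∈-upTo⁺; ∈-upTo⁻)
  open import Data.List.Properties using (map-tabulate)
  open import Algebra.Properties.CommutativeSemigroup +-commutativeSemigroup using (x∙yz≈y∙xz)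

  maxℕ-ub : ∀ {x xs} → x ∈ˡ xs → x ≤ maxℕ xs
  maxℕ-ub {xs = y ∷ xs} (here refl) = m≤m⊔n y (maxℕ xs)
  maxℕ-ub {xs = y ∷ xs} (there x∈xs) = ≤-trans (maxℕ-ub x∈xs) (m≤n⊔m y (maxℕ xs))

  maxℕ-attained : ∀ xs → maxℕ xs ≡ 0 ⊎ maxℕ xs ∈ˡ xs
  maxℕ-attained = foldr-selective ⊔-sel 0

  anyᵇ⁻ : ∀ {A : Set} {P : A → Bool} xs → anyᵇ P xs ≡ true → ∃ λ x → x ∈ˡ xs × P x ≡ true
  anyᵇ⁻ {P = P} (x ∷ xs) any≡true with P x in Px≡true
  ... | true  = x , here refl , Px≡true
  ... | false = let y , y∈xs , Py≡true = anyᵇ⁻ xs any≡true in y , there y∈xs , Py≡true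

  anyᵇ⁺ : ∀ {A : Set} {P : A → Bool} {x} xs → x ∈ˡ xs → P x ≡ true → anyᵇ P xs ≡ true
  anyᵇ⁺ {P = P} (y ∷ xs) (here refl)  Px≡true rewrite Px≡true = refl
  anyᵇ⁺ {P = P} (y ∷ xs) (there x∈xs) Px≡true with P y
  ... | true  = refl
  ... | false = anyᵇ⁺ xs x∈xs Px≡true

  first-satisfying-unique : ∀ {A : Set} (P : A → Bool) {x d : A} xs → x ∈ˡ xs → P x ≡ true →
                 (∀ {y} → P y ≡ true → y ≡ x) → foldr (λ y r → if P y then y else r) d xs ≡ x
  first-satisfying-unique P (y ∷ xs) x∈y∷xs Px≡true unique with P y in Py | x∈y∷xs
  ... | true  | _            = unique Py
  ... | false | here refl    = contradiction (trans (sym Px≡true) Py) λ ()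
  ... | false | there x∈xs   = first-satisfying-unique P xs x∈xs Px≡true unique

  ∈-range⁺ : ∀ {a c x} → a ≤ x → x ≤ c → x ∈ˡ range a c
  ∈-range⁺ {a} {c} {x} a≤x x≤c = subst (_∈ˡ range a c) (m+[n∸m]≡n a≤x)
    (∈-map⁺ (a +_) (∈-upTo⁺ (subst (x ∸ a <_) (sym (+-∸-assoc 1 (≤-trans a≤x x≤c)))
                                   (s≤s (∸-monoˡ-≤ a x≤c)))))

  ∈-range⁻ : ∀ {a c x} → x ∈ˡ range a c → a ≤ x × x ≤ c
  ∈-range⁻ {a} {c} x∈range with ∈-map⁻ (a +_) x∈range
  ... | k , k∈upTo , refl =
    m≤m+n a k , subst (_≤ c) (+-comm k a) (≤-pred (m≤o∸n⇒m+n≤o (suc k) a≤1+c k<1+c∸a))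
    where
    k<1+c∸a : k < suc c ∸ a
    k<1+c∸a = ∈-upTo⁻ k∈upTo
    a≤1+c : a ≤ suc c
    a≤1+c = <⇒≤ (m∸n≢0⇒n<m (m<n⇒n≢0 k<1+c∸a))

  map-allFin-suc : ∀ {A : Set} {n} (f : Fin (suc n) → A) →
                   map f (allFin (suc n)) ≡ f zero ∷ map (f ∘ suc) (allFin n)
  map-allFin-suc f = cong (f zero ∷_) (trans (map-tabulate suc f) (sym (map-tabulate (λ x → x) (f ∘ suc))))

  sum-map-+ : ∀ {A : Set} (f g : A → ℕ) xs → sum (map (λ x → f x + g x) xs) ≡ sum (map f xs) + sum (map g xs)
  sum-map-+ f g []       = refl
  sum-map-+ f g (x ∷ xs) = begin
    f x + g x + sum (map (λ x → f x + g x) xs)  ≡⟨ cong (f x + g x +_) (sum-map-+ f g xs) ⟩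
    f x + g x + (∑f + ∑g)                       ≡⟨ +-assoc (f x) (g x) _ ⟩
    f x + (g x + (∑f + ∑g))                     ≡⟨ cong (f x +_) (x∙yz≈y∙xz (g x) ∑f ∑g) ⟩
    f x + (∑f + (g x + ∑g))                     ≡⟨ +-assoc (f x) _ _ ⟨
    f x + ∑f + (g x + ∑g)                       ∎
    where
    open ≡-Reasoning
    ∑f = sum (map f xs)
    ∑g = sum (map g xs)

  sum-map-*ˡ : ∀ {A : Set} k (f : A → ℕ) xs → sum (map (λ x → k * f x) xs) ≡ k * sum (map f xs)
  sum-map-*ˡ k f []       = sym (*-zeroʳ k)
  sum-map-*ˡ k f (x ∷ xs) = trans (cong (k * f x +_) (sum-map-*ˡ k f xs)) (sym (*-distribˡ-+ k (f x) _))

  sum-map-mono : ∀ {A : Set} {f g : A → ℕ} xs → (∀ x → f x ≤ g x) → sum (map f xs) ≤ sum (map g xs)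
  sum-map-mono []       _   = z≤n
  sum-map-mono (x ∷ xs) f≤g = +-mono-≤ (f≤g x) (sum-map-mono xs f≤g)

  sum-map-0 : ∀ {A : Set} (xs : List A) → sum (map (λ _ → 0) xs) ≡ 0
  sum-map-0 []       = refl
  sum-map-0 (_ ∷ xs) = sum-map-0 xs

  count-mono : ∀ {A : Set} {P Q : A → Bool} xs → (∀ x → P x ≡ true → Q x ≡ true) →
               count P xs ≤ count Q xs
  count-mono {P = P} {Q} []       _   = z≤n
  count-mono {P = P} {Q} (x ∷ xs) P⇒Q with P x in Px | Q x in Qx
  ... | true  | true  = s≤s (count-mono xs P⇒Q)
  ... | true  | false = contradiction (trans (sym (P⇒Q x Px)) Qx) λ ()
  ... | false | true  = m≤n⇒m≤1+n (count-mono xs P⇒Q)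
  ... | false | false = count-mono xs P⇒Q

  count-∧ : ∀ {A : Set} b (P : A → Bool) xs → count (λ x → b ∧ P x) xs ≡ (if b then count P xs else 0)
  count-∧ true  P xs       = refl
  count-∧ false P []       = refl
  count-∧ false P (_ ∷ xs) = count-∧ false P xs

  count≡sum : ∀ {A : Set} (P : A → Bool) xs → count P xs ≡ sum (map (λ x → if P x then 1 else 0) xs)
  count≡sum P []       = refl
  count≡sum P (x ∷ xs) with P x
  ... | true  = cong suc (count≡sum P xs)
  ... | false = count≡sum P xs

  count-++ : ∀ {A : Set} (P : A → Bool) xs ys → count P (xs ++ ys) ≡ count P xs + count P ys
  count-++ P []       ys = refl
  count-++ P (x ∷ xs) ys with P x
  ... | true  = cong suc (count-++ P xs ys)
  ... | false = count-++ P xs ys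

  count-map : ∀ {A B : Set} (P : B → Bool) (f : A → B) xs → count P (map f xs) ≡ count (P ∘ f) xs
  count-map P f []       = refl
  count-map P f (x ∷ xs) with P (f x)
  ... | true  = cong suc (count-map P f xs)
  ... | false = count-map P f xs

module Counting where
  open import Data.Nat using (_*_)
  open import Data.List using (length)
  open import Data.List.Properties using (length-++; length-map)
  open Lists
  open ≡-Reasoning

  ∣∷∣ : ∀ {n} b (p : Subset n) → ∣ b ∷ p ∣ ≡ (if b then 1 else 0) + ∣ p ∣
  ∣∷∣ true  p = refl
  ∣∷∣ false p = refl

  sum-∣setOf∣≡sum-count : ∀ {A : Set} {n} (F : Fin n → A → Bool) xs →
                sum (map (λ x → ∣ setOf (λ e → F e x) ∣) xs) ≡ sum (map (λ e → count (F e) xs) (allFin n))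
  sum-∣setOf∣≡sum-count {n = zero}  F xs = sum-map-0 xs
  sum-∣setOf∣≡sum-count {n = suc n} F xs = begin
    sum (map (λ x → ∣ setOf (λ e → F e x) ∣) xs)
      ≡⟨ cong sum (map-cong (λ x → ∣∷∣ (F zero x) (setOf (λ e → F (suc e) x))) xs) ⟩
    sum (map (λ x → (if F zero x then 1 else 0) + ∣ setOf (λ e → F (suc e) x) ∣) xs)
      ≡⟨ sum-map-+ (λ x → if F zero x then 1 else 0) (λ x → ∣ setOf (λ e → F (suc e) x) ∣) xs ⟩
    sum (map (λ x → if F zero x then 1 else 0) xs) + sum (map (λ x → ∣ setOf (λ e → F (suc e) x) ∣) xs)
      ≡⟨ cong₂ _+_ (count≡sum (F zero) xs) (sym (sum-∣setOf∣≡sum-count (F ∘ suc) xs)) ⟨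
    count (F zero) xs + sum (map (λ e → count (F (suc e)) xs) (allFin n))
      ≡⟨ cong sum (map-allFin-suc (λ e → count (F e) xs)) ⟨
    sum (map (λ e → count (F e) xs) (allFin (suc n)))
      ∎
    where open import Data.List.Properties using (map-cong)

  length-allSubsets : ∀ n → length (allSubsets n) ≡ 2 ^ n
  length-allSubsets zero    = refl
  length-allSubsets (suc n) = begin
    length (map (false ∷_) (allSubsets n) ++ map (true ∷_) (allSubsets n))
      ≡⟨ length-++ (map (false ∷_) (allSubsets n)) ⟩
    length (map (false ∷_) (allSubsets n)) + length (map (true ∷_) (allSubsets n))
      ≡⟨ cong₂ _+_ (length-map (false ∷_) (allSubsets n)) (length-map (true ∷_) (allSubsets n)) ⟩
    length (allSubsets n) + length (allSubsets n)
      ≡⟨ cong₂ _+_ (length-allSubsets n) (trans (length-allSubsets n) (sym (+-identityʳ (2 ^ n)))) ⟩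
    2 ^ n + (2 ^ n + 0)
      ∎

  count-allSubsets : ∀ {n} (P : Subset (suc n) → Bool) → count P (allSubsets (suc n)) ≡
                     count (P ∘ (false ∷_)) (allSubsets n) + count (P ∘ (true ∷_)) (allSubsets n)
  count-allSubsets {n} P = trans (count-++ P (map (false ∷_) (allSubsets n)) _)
    (cong₂ _+_ (count-map P (false ∷_) (allSubsets n)) (count-map P (true ∷_) (allSubsets n)))

  count-∉ : ∀ {n} (e : Fin (suc n)) → count (λ S → not (e ∈ᵇ S)) (allSubsets (suc n)) ≡ 2 ^ n
  count-∉ {n} zero = begin
    count (λ S → not (zero ∈ᵇ S)) (allSubsets (suc n))
      ≡⟨ count-allSubsets {n} (λ S → not (zero ∈ᵇ S)) ⟩
    count (λ _ → true) (allSubsets n) + count (λ _ → false) (allSubsets n)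
      ≡⟨ cong₂ _+_ (count-true (allSubsets n)) (count-false (allSubsets n)) ⟩
    length (allSubsets n) + 0
      ≡⟨ +-identityʳ _ ⟩
    length (allSubsets n)
      ≡⟨ length-allSubsets n ⟩
    2 ^ n
      ∎
    where
    count-true : ∀ {A : Set} (xs : List A) → count (λ _ → true) xs ≡ length xs
    count-true []       = refl
    count-true (_ ∷ xs) = cong suc (count-true xs)
    count-false : ∀ {A : Set} (xs : List A) → count (λ _ → false) xs ≡ 0
    count-false []       = refl
    count-false (_ ∷ xs) = count-false xs
  count-∉ {suc n} (suc e) = begin
    count (λ S → not (suc e ∈ᵇ S)) (allSubsets (suc (suc n)))
      ≡⟨ count-allSubsets {suc n} (λ S → not (suc e ∈ᵇ S)) ⟩
    count (λ S → not (e ∈ᵇ S)) (allSubsets (suc n)) + count (λ S → not (e ∈ᵇ S)) (allSubsets (suc n))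
      ≡⟨ cong₂ _+_ (count-∉ e) (trans (count-∉ e) (sym (+-identityʳ (2 ^ n)))) ⟩
    2 ^ n + (2 ^ n + 0)
      ∎

  2*count-∉ : ∀ {n} (e : Fin n) → 2 * count (λ S → not (e ∈ᵇ S)) (allSubsets n) ≡ 2 ^ n
  2*count-∉ {suc n} e = cong (2 *_) (count-∉ e)

module Fractions where
  open import Data.Nat using (_≤_; _*_; NonZero)
  open import Data.Integer as ℤ using (+_)
  import Data.Integer.Properties as ℤP
  open import Data.Integer.Solver using (module +-*-Solver)
  open import Data.Rational using (_/_; fromℚᵘ)
  open import Data.Rational.Unnormalised as ℚᵘ using (mkℚᵘ; *≡*; *≤*)
  import Data.Rational.Unnormalised.Properties as ℚᵘP
  open +-*-Solver

  -- + a / suc k is by definition fromℚᵘ (mkℚᵘ (+ a) k), so these identities reduce to ones in ℚᵘ.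

  fromℚᵘ-homo-+ : ∀ p q → fromℚᵘ (p ℚᵘ.+ q) ≡ fromℚᵘ p ℚ.+ fromℚᵘ q
  fromℚᵘ-homo-+ p q = ℚP.toℚᵘ-injective (ℚᵘP.≃-trans (ℚP.toℚᵘ-fromℚᵘ _) (ℚᵘP.≃-sym
    (ℚᵘP.≃-trans (ℚP.toℚᵘ-homo-+ (fromℚᵘ p) (fromℚᵘ q))
                 (ℚᵘP.+-cong (ℚP.toℚᵘ-fromℚᵘ p) (ℚP.toℚᵘ-fromℚᵘ q)))))

  fromℚᵘ-homo-* : ∀ p q → fromℚᵘ (p ℚᵘ.* q) ≡ fromℚᵘ p ℚ.* fromℚᵘ q
  fromℚᵘ-homo-* p q = ℚP.toℚᵘ-injective (ℚᵘP.≃-trans (ℚP.toℚᵘ-fromℚᵘ _) (ℚᵘP.≃-sym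
    (ℚᵘP.≃-trans (ℚP.toℚᵘ-homo-* (fromℚᵘ p) (fromℚᵘ q))
                 (ℚᵘP.*-cong (ℚP.toℚᵘ-fromℚᵘ p) (ℚP.toℚᵘ-fromℚᵘ q)))))

  a/d+b/d≡[a+b]/d : ∀ a b d .{{_ : NonZero d}} → + a / d ℚ.+ + b / d ≡ + (a + b) / d
  a/d+b/d≡[a+b]/d a b (suc k) =
    trans (sym (fromℚᵘ-homo-+ (mkℚᵘ (+ a) k) (mkℚᵘ (+ b) k)))
          (ℚP.fromℚᵘ-cong {mkℚᵘ (+ a) k ℚᵘ.+ mkℚᵘ (+ b) k} {mkℚᵘ (+ (a + b)) k} (*≡* cross))
    where
    cross : (+ a ℤ.* + suc k ℤ.+ + b ℤ.* + suc k) ℤ.* + suc k ≡ + (a + b) ℤ.* + (suc k * suc k)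
    cross rewrite ℤP.pos-+ a b | ℤP.pos-* (suc k) (suc k) =
      solve 3 (λ A B K → (A :* K :+ B :* K) :* K := (A :+ B) :* (K :* K)) refl (+ a) (+ b) (+ suc k)

  /-monoˡ-≤ : ∀ {a b} d .{{_ : NonZero d}} → a ≤ b → + a / d ℚ.≤ + b / d
  /-monoˡ-≤ {a} {b} (suc k) a≤b = ℚP.toℚᵘ-cancel-≤
    (ℚᵘP.≤-respʳ-≃ (ℚᵘP.≃-sym (ℚP.toℚᵘ-fromℚᵘ (mkℚᵘ (+ b) k)))
      (ℚᵘP.≤-respˡ-≃ (ℚᵘP.≃-sym (ℚP.toℚᵘ-fromℚᵘ (mkℚᵘ (+ a) k))) (*≤* cross)))
    where
    cross : + a ℤ.* + suc k ℤ.≤ + b ℤ.* + suc k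
    cross rewrite sym (ℤP.pos-* a (suc k)) | sym (ℤP.pos-* b (suc k)) = ℤ.+≤+ (*-monoˡ-≤ (suc k) a≤b)

  /-monoʳ-≤ : ∀ a {d d′} .{{_ : NonZero d}} .{{_ : NonZero d′}} → d ≤ d′ → + a / d′ ℚ.≤ + a / d
  /-monoʳ-≤ a {suc k} {suc k′} d≤d′ = ℚP.toℚᵘ-cancel-≤
    (ℚᵘP.≤-respʳ-≃ (ℚᵘP.≃-sym (ℚP.toℚᵘ-fromℚᵘ (mkℚᵘ (+ a) k)))
      (ℚᵘP.≤-respˡ-≃ (ℚᵘP.≃-sym (ℚP.toℚᵘ-fromℚᵘ (mkℚᵘ (+ a) k′))) (*≤* cross)))
    where
    cross : + a ℤ.* + suc k ℤ.≤ + a ℤ.* + suc k′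
    cross rewrite sym (ℤP.pos-* a (suc k)) | sym (ℤP.pos-* a (suc k′)) = ℤ.+≤+ (*-monoʳ-≤ a d≤d′)

  n/n≡1 : ∀ d .{{_ : NonZero d}} → + d / d ≡ 1ℚ
  n/n≡1 (suc k) = ℚP.fromℚᵘ-cong {mkℚᵘ (+ suc k) k} {mkℚᵘ (+ 1) 0}
    (*≡* (trans (ℤP.*-identityʳ (+ suc k)) (sym (ℤP.*-identityˡ (+ suc k)))))

  ¼*2a/d≡a/2d : ∀ a d .{{_ : NonZero d}} →
                (+ 1 / 4) ℚ.* (+ (2 * a) / d) ≡ (+ a / (2 * d)) {{m*n≢0 2 d}}
  ¼*2a/d≡a/2d a (suc k) =
    trans (sym (fromℚᵘ-homo-* (mkℚᵘ (+ 1) 3) (mkℚᵘ (+ (2 * a)) k)))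
          (ℚP.fromℚᵘ-cong {mkℚᵘ (+ 1) 3 ℚᵘ.* mkℚᵘ (+ (2 * a)) k} {mkℚᵘ (+ a) (k + suc (k + 0))}
                          (*≡* cross))
    where
    cross : (+ 1 ℤ.* + (2 * a)) ℤ.* + (2 * suc k) ≡ + a ℤ.* + (4 * suc k)
    cross = begin
      (+ 1 ℤ.* + (2 * a)) ℤ.* + (2 * suc k)
        ≡⟨ cong₂ (λ u v → (+ 1 ℤ.* u) ℤ.* v) (ℤP.pos-* 2 a) (ℤP.pos-* 2 (suc k)) ⟩
      (+ 1 ℤ.* (+ 2 ℤ.* + a)) ℤ.* (+ 2 ℤ.* + suc k)
        ≡⟨ solve 2 (λ A K → (con (+ 1) :* (con (+ 2) :* A)) :* (con (+ 2) :* K) := A :* (con (+ 4) :* K))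
                 refl (+ a) (+ suc k) ⟩
      + a ℤ.* (+ 4 ℤ.* + suc k)
        ≡⟨ cong (+ a ℤ.*_) (ℤP.pos-* 4 (suc k)) ⟨
      + a ℤ.* + (4 * suc k)
        ∎
      where open ≡-Reasoning

  sumℚ-map-/ : ∀ {A : Set} (f : A → ℕ) d .{{_ : NonZero d}} xs →
               sumℚ (map (λ x → + f x / d) xs) ≡ + sum (map f xs) / d
  sumℚ-map-/ f d []       = sym (ℚP.0/n≡0 d)
  sumℚ-map-/ f d (x ∷ xs) =
    trans (cong (+ f x / d ℚ.+_) (sumℚ-map-/ f d xs)) (a/d+b/d≡[a+b]/d (f x) (sum (map f xs)) d)

  sumℚ-map-mono : ∀ {A : Set} {f g : A → ℚ} xs → (∀ x → f x ℚ.≤ g x) →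
                  sumℚ (map f xs) ℚ.≤ sumℚ (map g xs)
  sumℚ-map-mono []       _   = ℚP.≤-refl
  sumℚ-map-mono (x ∷ xs) f≤g = ℚP.+-mono-≤ (f≤g x) (sumℚ-map-mono xs f≤g)

  divPow2-anti : ∀ {W} → 0ℚ ℚ.< W → ∀ {a c} → a ≤ c → divPow2 W c ℚ.≤ divPow2 W a
  divPow2-anti {W} W-pos {a} {c} a≤c = ℚP.*-monoˡ-≤-nonNeg W {{ℚP.pos⇒nonNeg W {{ℚ.positive W-pos}}}}
    (/-monoʳ-≤ 1 {{m^n≢0 2 a}} {{m^n≢0 2 c}} (^-monoʳ-≤ 2 a≤c))


module Weights where
  open import Data.Bool.Properties using (∨-identityʳ)
  open Lists using (map-allFin-suc)
  open ≡-Reasoning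

  weight-∷ : ∀ {n} (w : Fin (suc n) → ℚ) b (A : Subset n) →
             weight w (b ∷ A) ≡ (if b then w zero else 0ℚ) ℚ.+ weight (w ∘ suc) A
  weight-∷ w b A = cong sumℚ (map-allFin-suc (λ x → if x ∈ᵇ (b ∷ A) then w x else 0ℚ))

  weight-∪⁅⁆ : ∀ {n} (w : Fin n → ℚ) {A x} → x ∉ A → weight w (A ∪ ⁅ x ⁆) ≡ weight w A ℚ.+ w x
  weight-∪⁅⁆ w {false ∷ A} {zero} _ = begin
    weight w (true ∷ A ∪ ⊥)                 ≡⟨ weight-∷ w true (A ∪ ⊥) ⟩
    w zero ℚ.+ weight (w ∘ suc) (A ∪ ⊥)     ≡⟨ cong (λ S → w zero ℚ.+ weight (w ∘ suc) S) (∪-identityʳ A) ⟩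
    w zero ℚ.+ weight (w ∘ suc) A           ≡⟨ ℚP.+-comm (w zero) _ ⟩
    weight (w ∘ suc) A ℚ.+ w zero           ≡⟨ cong (ℚ._+ w zero) (ℚP.+-identityˡ (weight (w ∘ suc) A)) ⟨
    0ℚ ℚ.+ weight (w ∘ suc) A ℚ.+ w zero    ≡⟨ cong (ℚ._+ w zero) (weight-∷ w false A) ⟨
    weight w (false ∷ A) ℚ.+ w zero         ∎
  weight-∪⁅⁆ w {true ∷ A} {zero} x∉A = contradiction here x∉A
  weight-∪⁅⁆ w {b ∷ A} {suc x} x∉A = begin
    weight w ((b ∨ false) ∷ A ∪ ⁅ x ⁆)                ≡⟨ weight-∷ w (b ∨ false) (A ∪ ⁅ x ⁆) ⟩
    w₀ (b ∨ false) ℚ.+ weight (w ∘ suc) (A ∪ ⁅ x ⁆)   ≡⟨ cong₂ ℚ._+_ (cong w₀ (∨-identityʳ b))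
                                                                  (weight-∪⁅⁆ (w ∘ suc) (x∉A ∘ there)) ⟩
    w₀ b ℚ.+ (weight (w ∘ suc) A ℚ.+ w (suc x))       ≡⟨ ℚP.+-assoc (w₀ b) _ _ ⟨
    w₀ b ℚ.+ weight (w ∘ suc) A ℚ.+ w (suc x)         ≡⟨ cong (ℚ._+ w (suc x)) (weight-∷ w b A) ⟨
    weight w (b ∷ A) ℚ.+ w (suc x)                    ∎
    where
    w₀ : Bool → ℚ
    w₀ c = if c then w zero else 0ℚ

module MatroidRank {n : ℕ} (M : Matroid n) where
  open import Data.Nat using (_≤_; _<_)
  open import Algebra.Properties.CommutativeSemigroup +-commutativeSemigroup using (xy∙z≈xz∙y)
  open ≤-Reasoning
  open Matroid M
  open Subsets
  open Lists

  private
    variable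
      A B I J O X Y : Subset n
      x : Fin n

  Independent : Subset n → Set
  Independent I = indep I ≡ true

  private
    candidate : Subset n → Subset n → ℕ
    candidate A J = if (J ⊆ᵇ A) ∧ indep J then ∣ J ∣ else 0

  independent-⊆ : I ⊆ J → Independent J → Independent I
  independent-⊆ {I} {J} I⊆J = indep-down I J (⊆⇒⊆ᵇ I⊆J)

  augment : Independent I → Independent J → ∣ I ∣ < ∣ J ∣ →
            ∃ λ x → x ∈ J × x ∉ I × Independent (I ∪ ⁅ x ⁆)
  augment {I} {J} indI indJ ∣I∣<∣J∣ with indep-exch I J indI indJ ∣I∣<∣J∣
  ... | x , x∈J , x∉I , indIx = x , ∈ᵇ⇒∈ x∈J , ∈ᵇ≡false⇒∉ x∉I , indIx

  record IsBasis (A I : Subset n) : Set where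
    constructor isBasis
    field
      ⊆A          : I ⊆ A
      independent : Independent I
      ∣∣≡rank     : ∣ I ∣ ≡ rank M A

  open IsBasis

  ∣∣≤rank : Independent I → I ⊆ A → ∣ I ∣ ≤ rank M A
  ∣∣≤rank {I} {A} indI I⊆A =
    subst (_≤ rank M A) value (maxℕ-ub (∈-map⁺ (candidate A) (allSubsets-complete I)))
    where
    value : candidate A I ≡ ∣ I ∣
    value rewrite ⊆⇒⊆ᵇ I⊆A | indI = refl

  ∣∩∣≤rank : Independent I → ∀ A → ∣ I ∩ A ∣ ≤ rank M A
  ∣∩∣≤rank {I} indI A = ∣∣≤rank (independent-⊆ (p∩q⊆p I A) indI) (p∩q⊆q I A)

  basis : ∀ A → ∃ (IsBasis A)
  basis A with maxℕ-attained (map (candidate A) (allSubsets n))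
  ... | inj₁ rank≡0 = ⊥ , isBasis ⊥⊆ indep-empty (trans (∣⊥∣≡0 n) (sym rank≡0))
  ... | inj₂ rank∈ with ∈-map⁻ _ rank∈
  ...   | I , _ , rank≡ with I ⊆ᵇ A in I⊆A | indep I in indI
  ...     | true  | true  = I , isBasis (⊆ᵇ⇒⊆ I⊆A) indI (sym rank≡)
  ...     | true  | false = ⊥ , isBasis ⊥⊆ indep-empty (trans (∣⊥∣≡0 n) (sym rank≡))
  ...     | false | _     = ⊥ , isBasis ⊥⊆ indep-empty (trans (∣⊥∣≡0 n) (sym rank≡))

  extend-to-basis : Independent I → I ⊆ A → ∃ λ Q → I ⊆ Q × IsBasis A Q
  extend-to-basis {I} {A} = extend (rank M A) (m≤m+n _ _)
    where
    extend : ∀ k {I} → rank M A ≤ k + ∣ I ∣ → Independent I → I ⊆ A →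
             ∃ λ Q → I ⊆ Q × IsBasis A Q
    extend k {I} bound indI I⊆A with ∣ I ∣ <? rank M A
    ... | no ∣I∣≮rank =
      I , ⊆-refl , isBasis I⊆A indI (≤-antisym (∣∣≤rank indI I⊆A) (≮⇒≥ ∣I∣≮rank))
    ... | yes ∣I∣<rank with k | basis A
    ...   | zero  | _ = contradiction bound (<⇒≱ ∣I∣<rank)
    ...   | suc k | B , basisB
      with augment indI (independent basisB) (subst (∣ I ∣ <_) (sym (∣∣≡rank basisB)) ∣I∣<rank)
    ...     | x , x∈B , x∉I , indIx =
      let Q , Ix⊆Q , basisQ = extend k bound′ indIx (∪-lub I⊆A (x∈p⇒⁅x⁆⊆p (⊆A basisB x∈B)))
      in Q , ⊆-trans (p⊆p∪q ⁅ x ⁆) Ix⊆Q , basisQ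
      where
      bound′ : rank M A ≤ k + ∣ I ∪ ⁅ x ⁆ ∣
      bound′ = subst (rank M A ≤_) (trans (sym (+-suc k ∣ I ∣)) (cong (k +_) (sym (∣p∪⁅x⁆∣≡1+∣p∣ x∉I))))
                     bound

  rank-mono : A ⊆ B → rank M A ≤ rank M B
  rank-mono {A} {B} A⊆B =
    let I , basisI = basis A
    in subst (_≤ rank M B) (∣∣≡rank basisI) (∣∣≤rank (independent basisI) (⊆-trans (⊆A basisI) A⊆B))

  rank-∪-≤ : ∀ A B → rank M (A ∪ B) ≤ rank M A + ∣ B ∣
  rank-∪-≤ A B = let P , basisP = basis (A ∪ B) in begin
    rank M (A ∪ B)      ≡⟨ ∣∣≡rank basisP ⟨
    ∣ P ∣               ≤⟨ p⊆q⇒∣p∣≤∣q∣ (P⊆ (⊆A basisP)) ⟩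
    ∣ (P ∩ A) ∪ B ∣     ≤⟨ ∣p∪q∣≤∣p∣+∣q∣ (P ∩ A) B ⟩
    ∣ P ∩ A ∣ + ∣ B ∣   ≤⟨ +-monoˡ-≤ ∣ B ∣ (∣∩∣≤rank (independent basisP) A) ⟩
    rank M A + ∣ B ∣    ∎
    where
    P⊆ : ∀ {P} → P ⊆ A ∪ B → P ⊆ (P ∩ A) ∪ B
    P⊆ {P} P⊆A∪B x∈P with x∈p∪q⁻ A B (P⊆A∪B x∈P)
    ... | inj₁ x∈A = p⊆p∪q B (x∈p∩q⁺ (x∈P , x∈A))
    ... | inj₂ x∈B = q⊆p∪q (P ∩ A) B x∈B

  rank-submodular : ∀ A B → rank M (A ∪ B) + rank M (A ∩ B) ≤ rank M A + rank M B
  rank-submodular A B =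
    let I , basisI = basis (A ∩ B)
        J , I⊆J , basisJ = extend-to-basis (independent basisI)
                             (⊆-trans (⊆A basisI) (⊆-trans (p∩q⊆p A B) (p⊆p∪q B)))
        indJ = independent basisJ
    in begin
    rank M (A ∪ B) + rank M (A ∩ B)             ≡⟨ cong₂ _+_ (∣∣≡rank basisJ) (∣∣≡rank basisI) ⟨
    ∣ J ∣ + ∣ I ∣                               ≤⟨ +-mono-≤ (p⊆q⇒∣p∣≤∣q∣ (J⊆ (⊆A basisJ)))
                                                             (p⊆q⇒∣p∣≤∣q∣ (I⊆ I⊆J (⊆A basisI))) ⟩
    ∣ J ∩ A ∪ J ∩ B ∣ + ∣ (J ∩ A) ∩ (J ∩ B) ∣   ≡⟨ ∣p∪q∣+∣p∩q∣≡∣p∣+∣q∣ (J ∩ A) (J ∩ B) ⟩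
    ∣ J ∩ A ∣ + ∣ J ∩ B ∣                       ≤⟨ +-mono-≤ (∣∩∣≤rank indJ A) (∣∩∣≤rank indJ B) ⟩
    rank M A + rank M B                         ∎
    where
    J⊆ : ∀ {J} → J ⊆ A ∪ B → J ⊆ J ∩ A ∪ J ∩ B
    J⊆ {J} J⊆A∪B x∈J with x∈p∪q⁻ A B (J⊆A∪B x∈J)
    ... | inj₁ x∈A = p⊆p∪q (J ∩ B) (x∈p∩q⁺ (x∈J , x∈A))
    ... | inj₂ x∈B = q⊆p∪q (J ∩ A) (J ∩ B) (x∈p∩q⁺ (x∈J , x∈B))
    I⊆ : ∀ {I J} → I ⊆ J → I ⊆ A ∩ B → I ⊆ (J ∩ A) ∩ (J ∩ B)
    I⊆ I⊆J I⊆A∩B x∈I =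
      let x∈A , x∈B = x∈p∩q⁻ A B (I⊆A∩B x∈I)
      in x∈p∩q⁺ (x∈p∩q⁺ (I⊆J x∈I , x∈A) , x∈p∩q⁺ (I⊆J x∈I , x∈B))

  rank-∪-diminishing : ∀ Z → X ⊆ Y → rank M (Z ∪ Y) + rank M X ≤ rank M (Z ∪ X) + rank M Y
  rank-∪-diminishing {X} {Y} Z X⊆Y = begin
    rank M (Z ∪ Y) + rank M X                   ≤⟨ +-mono-≤ (rank-mono Z∪Y⊆) (rank-mono X⊆) ⟩
    rank M ((Z ∪ X) ∪ Y) + rank M ((Z ∪ X) ∩ Y) ≤⟨ rank-submodular (Z ∪ X) Y ⟩
    rank M (Z ∪ X) + rank M Y                   ∎
    where
    Z∪Y⊆ : Z ∪ Y ⊆ (Z ∪ X) ∪ Y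
    Z∪Y⊆ = ∪-lub (⊆-trans (p⊆p∪q X) (p⊆p∪q Y)) (q⊆p∪q (Z ∪ X) Y)
    X⊆ : X ⊆ (Z ∪ X) ∩ Y
    X⊆ = ∩-glb (q⊆p∪q Z X) X⊆Y

  inSpan-mono : A ⊆ B → inSpan M A x ≡ true → inSpan M B x ≡ true
  inSpan-mono {A} {B} {x} A⊆B x∈spanA =
    ⌊⌋-complete (rank M (B ∪ ⁅ x ⁆) ≟ rank M B)
      (≤-antisym (+-cancelʳ-≤ (rank M A) _ _ increment) (rank-mono (p⊆p∪q ⁅ x ⁆)))
    where
    increment : rank M (B ∪ ⁅ x ⁆) + rank M A ≤ rank M B + rank M A
    increment = begin
      rank M (B ∪ ⁅ x ⁆) + rank M A   ≡⟨ cong (λ S → rank M S + rank M A) (∪-comm B ⁅ x ⁆) ⟩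
      rank M (⁅ x ⁆ ∪ B) + rank M A   ≤⟨ rank-∪-diminishing ⁅ x ⁆ A⊆B ⟩
      rank M (⁅ x ⁆ ∪ A) + rank M B   ≡⟨ cong (λ S → rank M S + rank M B) (∪-comm ⁅ x ⁆ A) ⟩
      rank M (A ∪ ⁅ x ⁆) + rank M B   ≡⟨ cong (_+ rank M B) (⌊⌋-sound (rank M (A ∪ ⁅ x ⁆) ≟ rank M A) x∈spanA) ⟩
      rank M A + rank M B             ≡⟨ +-comm (rank M A) (rank M B) ⟩
      rank M B + rank M A             ∎

  -- I is independent in the contraction M / X.  indepContrRestr asks for equality, but the
  -- reverse inequality always holds (rank-∪-≤ʳ), so only this one is recorded.
  Independent/ : Subset n → Subset n → Set
  Independent/ X I = ∣ I ∣ + rank M X ≤ rank M (I ∪ X)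

  rank-∪-≤ʳ : ∀ I X → rank M (I ∪ X) ≤ ∣ I ∣ + rank M X
  rank-∪-≤ʳ I X = subst₂ _≤_ (cong (rank M) (∪-comm X I)) (+-comm (rank M X) ∣ I ∣) (rank-∪-≤ X I)

  independent/⇒rank≡ : Independent/ X I → rank M (I ∪ X) ≡ ∣ I ∣ + rank M X
  independent/⇒rank≡ {X} {I} = ≤-antisym (rank-∪-≤ʳ I X)

  independent/-⊥ : Independent/ X ⊥
  independent/-⊥ {X} =
    subst₂ _≤_ (cong (_+ rank M X) (sym (∣⊥∣≡0 n))) (cong (rank M) (sym (∪-identityˡ X))) ≤-refl

  independent/-⊆ : J ⊆ I → Independent/ X I → Independent/ X J
  independent/-⊆ {J} {I} {X} J⊆I indI = +-cancelˡ-≤ ∣ D ∣ _ _ (begin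
    ∣ D ∣ + (∣ J ∣ + rank M X)    ≡⟨ +-assoc ∣ D ∣ ∣ J ∣ (rank M X) ⟨
    ∣ D ∣ + ∣ J ∣ + rank M X      ≡⟨ cong (_+ rank M X) (∣p∪q∣≡∣p∣+∣q∣ (p─q#q I J)) ⟨
    ∣ D ∪ J ∣ + rank M X          ≤⟨ +-monoˡ-≤ (rank M X) (p⊆q⇒∣p∣≤∣q∣ (∪-lub (p─q⊆p I J) J⊆I)) ⟩
    ∣ I ∣ + rank M X              ≤⟨ indI ⟩
    rank M (I ∪ X)                ≤⟨ rank-mono I∪X⊆ ⟩
    rank M ((J ∪ X) ∪ D)          ≤⟨ rank-∪-≤ (J ∪ X) D ⟩
    rank M (J ∪ X) + ∣ D ∣        ≡⟨ +-comm (rank M (J ∪ X)) ∣ D ∣ ⟩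
    ∣ D ∣ + rank M (J ∪ X)        ∎)
    where
    D = I ─ J
    I⊆ : I ⊆ (J ∪ X) ∪ D
    I⊆ {x} x∈I with x ∈? J
    ... | yes x∈J = p⊆p∪q D (p⊆p∪q X x∈J)
    ... | no  x∉J = q⊆p∪q (J ∪ X) D (x∈p∧x∉q⇒x∈p─q x∈I x∉J)
    I∪X⊆ : I ∪ X ⊆ (J ∪ X) ∪ D
    I∪X⊆ = ∪-lub I⊆ (⊆-trans (q⊆p∪q J X) (p⊆p∪q D))

  independent/-antitone : X ⊆ Y → Independent/ Y I → Independent/ X I
  independent/-antitone {X} {Y} {I} X⊆Y indI = +-cancelʳ-≤ (rank M Y) _ _ (begin
    ∣ I ∣ + rank M X + rank M Y   ≡⟨ xy∙z≈xz∙y ∣ I ∣ (rank M X) (rank M Y) ⟩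
    ∣ I ∣ + rank M Y + rank M X   ≤⟨ +-monoˡ-≤ (rank M X) indI ⟩
    rank M (I ∪ Y) + rank M X     ≤⟨ rank-∪-diminishing I X⊆Y ⟩
    rank M (I ∪ X) + rank M Y     ∎)

  independent/-outside : Independent O → J ⊆ O → Disjoint J Y → rank M Y ≤ ∣ O ∩ Y ∣ →
                         Independent/ Y J
  independent/-outside {O} {J} {Y} indO J⊆O J#Y rankY≤ = begin
    ∣ J ∣ + rank M Y       ≤⟨ +-monoʳ-≤ ∣ J ∣ rankY≤ ⟩
    ∣ J ∣ + ∣ O ∩ Y ∣      ≡⟨ ∣p∪q∣≡∣p∣+∣q∣ (λ x∈J → J#Y x∈J ∘ p∩q⊆q O Y) ⟨
    ∣ J ∪ O ∩ Y ∣          ≤⟨ ∣∣≤rank (independent-⊆ (∪-lub J⊆O (p∩q⊆p O Y)) indO)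
                                     (∪-lub (p⊆p∪q Y) (⊆-trans (p∩q⊆q O Y) (q⊆p∪q J Y))) ⟩
    rank M (J ∪ Y)         ∎

  independent/-augment : Independent/ X I → Independent/ X J → ∣ I ∣ < ∣ J ∣ →
                         ∃ λ x → x ∈ J × x ∉ I × Independent/ X (I ∪ ⁅ x ⁆)
  independent/-augment {X} {I} {J} indI indJ ∣I∣<∣J∣
    with basis (I ∪ X) | basis (J ∪ X)
  ... | P , basisP | Q , basisQ
    with augment (independent basisP) (independent basisQ) ∣P∣<∣Q∣
    where
    ∣P∣<∣Q∣ : ∣ P ∣ < ∣ Q ∣
    ∣P∣<∣Q∣ = begin-strict
      ∣ P ∣                ≡⟨ ∣∣≡rank basisP ⟩
      rank M (I ∪ X)       ≤⟨ rank-∪-≤ʳ I X ⟩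
      ∣ I ∣ + rank M X     <⟨ +-monoˡ-< (rank M X) ∣I∣<∣J∣ ⟩
      ∣ J ∣ + rank M X     ≤⟨ indJ ⟩
      rank M (J ∪ X)       ≡⟨ ∣∣≡rank basisQ ⟨
      ∣ Q ∣                ∎
  ... | x , x∈Q , x∉P , indPx with x ∈? I ∪ X
  ...   | yes x∈I∪X = contradiction (∣∣≤rank indPx (∪-lub (⊆A basisP) (x∈p⇒⁅x⁆⊆p x∈I∪X))) too-large
    where
    too-large : ¬ ∣ P ∪ ⁅ x ⁆ ∣ ≤ rank M (I ∪ X)
    too-large = <⇒≱ (subst₂ _<_ (∣∣≡rank basisP) (sym (∣p∪⁅x⁆∣≡1+∣p∣ x∉P)) ≤-refl)
  ...   | no  x∉I∪X = x , x∈J , x∉I , (begin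
      ∣ I ∪ ⁅ x ⁆ ∣ + rank M X     ≡⟨ cong (_+ rank M X) (∣p∪⁅x⁆∣≡1+∣p∣ x∉I) ⟩
      suc (∣ I ∣ + rank M X)       ≤⟨ s≤s indI ⟩
      suc (rank M (I ∪ X))         ≡⟨ cong suc (∣∣≡rank basisP) ⟨
      suc ∣ P ∣                    ≡⟨ ∣p∪⁅x⁆∣≡1+∣p∣ x∉P ⟨
      ∣ P ∪ ⁅ x ⁆ ∣                ≤⟨ ∣∣≤rank indPx (∪-lub P⊆ (x∈p⇒⁅x⁆⊆p (p⊆p∪q X (q⊆p∪q I ⁅ x ⁆ (x∈⁅x⁆ x))))) ⟩
      rank M ((I ∪ ⁅ x ⁆) ∪ X)     ∎)
    where
    x∉I : x ∉ I
    x∉I = x∉I∪X ∘ p⊆p∪q X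
    x∈J : x ∈ J
    x∈J with x∈p∪q⁻ J X (⊆A basisQ x∈Q)
    ... | inj₁ x∈J = x∈J
    ... | inj₂ x∈X = contradiction (q⊆p∪q I X x∈X) x∉I∪X
    P⊆ : P ⊆ (I ∪ ⁅ x ⁆) ∪ X
    P⊆ = ⊆-trans (⊆A basisP) (∪-lub (⊆-trans (p⊆p∪q ⁅ x ⁆) (p⊆p∪q X)) (q⊆p∪q (I ∪ ⁅ x ⁆) X))

module MaxWeightBasis {n : ℕ} (M : Matroid n) (w : Fin n → ℚ) (w-pos : ∀ x → 0ℚ ℚ.< w x)
                      (OPT : Subset n) (opt : IsUniqueMaxWeightBasis M w OPT) where
  open import Data.Nat using (_≤_; _<_)
  open MatroidRank M
  open IsBasis
  open Subsets
  open Weights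

  private
    variable
      A D I Y : Subset n
      x y : Fin n

  independent-OPT : Independent OPT
  independent-OPT = proj₁ opt

  ∪⁅x⁆≢OPT : x ∉ OPT → A ∪ ⁅ x ⁆ ≢ OPT
  ∪⁅x⁆≢OPT {x} {A} x∉OPT A∪x≡OPT = x∉OPT (subst (x ∈_) A∪x≡OPT (x∈p∪⁅x⁆ A x))

  ∣∣≤∣OPT∣ : Independent I → ∣ I ∣ ≤ ∣ OPT ∣
  ∣∣≤∣OPT∣ {I} indI with ∣ I ∣ ≤? ∣ OPT ∣
  ... | yes ∣I∣≤∣OPT∣ = ∣I∣≤∣OPT∣
  ... | no  ∣I∣≰∣OPT∣ with augment independent-OPT indI (≰⇒> ∣I∣≰∣OPT∣)
  ...   | x , _ , x∉OPT , indOPTx =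
    contradiction (proj₂ opt _ indOPTx (∪⁅x⁆≢OPT x∉OPT)) (ℚP.<-asym heavier)
    where
    heavier : weight w OPT ℚ.< weight w (OPT ∪ ⁅ x ⁆)
    heavier = subst₂ ℚ._<_ (ℚP.+-identityʳ (weight w OPT)) (sym (weight-∪⁅⁆ w x∉OPT))
                (ℚP.+-monoʳ-< (weight w OPT) (w-pos x))

  lighter-than-swapped : D ∪ ⁅ y ⁆ ≡ OPT → y ∉ D → x ∉ OPT → Independent (D ∪ ⁅ x ⁆) →
                         w x ℚ.< w y
  lighter-than-swapped {D} {y} {x} D∪y≡OPT y∉D x∉OPT indDx with w x ℚP.<? w y
  ... | yes wx<wy = wx<wy
  ... | no  wx≮wy = ⊥-elim (ℚP.<-irrefl refl (ℚP.<-≤-trans (proj₂ opt _ indDx (∪⁅x⁆≢OPT x∉OPT)) (begin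
      weight w OPT            ≡⟨ cong (weight w) D∪y≡OPT ⟨
      weight w (D ∪ ⁅ y ⁆)    ≡⟨ weight-∪⁅⁆ w y∉D ⟩
      weight w D ℚ.+ w y      ≤⟨ ℚP.+-monoʳ-≤ (weight w D) (ℚP.≮⇒≥ wx≮wy) ⟩
      weight w D ℚ.+ w x      ≡⟨ weight-∪⁅⁆ w (x∉OPT ∘ D⊆OPT) ⟨
      weight w (D ∪ ⁅ x ⁆)    ∎)))
    where
    open ℚP.≤-Reasoning
    D⊆OPT : D ⊆ OPT
    D⊆OPT = subst (D ⊆_) D∪y≡OPT (p⊆p∪q ⁅ y ⁆)

  swap-partner : A ⊆ OPT → x ∉ OPT → Independent (A ∪ ⁅ x ⁆) →
                 ∃ λ y → y ∈ OPT × y ∉ A × w x ℚ.< w y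
  swap-partner {A} {x} A⊆OPT x∉OPT indAx
    with extend-to-basis indAx (∪-lub (⊆-trans A⊆OPT (p⊆p∪q ⁅ x ⁆)) (q⊆p∪q OPT ⁅ x ⁆))
  ... | Q , A∪x⊆Q , basisQ with ∣p∣<∣q∣⇒∃∈q∖p ∣Q∩OPT∣<∣OPT∣
    where
    ∣Q∩OPT∣<∣OPT∣ : ∣ Q ∩ OPT ∣ < ∣ OPT ∣
    ∣Q∩OPT∣<∣OPT∣ = ≤-trans
      (p⊂q⇒∣p∣<∣q∣ (p∩q⊆p Q OPT , x , A∪x⊆Q (x∈p∪⁅x⁆ A x) , x∉OPT ∘ p∩q⊆q Q OPT))
      (∣∣≤∣OPT∣ (independent basisQ))
  ... | y , y∈OPT , y∉Q∩OPT =
    y , y∈OPT , y∉A , lighter-than-swapped Q∩OPT∪y≡OPT y∉Q∩OPT x∉OPT indQ∩OPT∪x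
    where
    open ≤-Reasoning
    x∈Q : x ∈ Q
    x∈Q = A∪x⊆Q (x∈p∪⁅x⁆ A x)
    y∉A : y ∉ A
    y∉A y∈A = y∉Q∩OPT (x∈p∩q⁺ (A∪x⊆Q (p⊆p∪q ⁅ x ⁆ y∈A) , y∈OPT))
    indQ∩OPT∪x : Independent (Q ∩ OPT ∪ ⁅ x ⁆)
    indQ∩OPT∪x = independent-⊆ (∪-lub (p∩q⊆p Q OPT) (x∈p⇒⁅x⁆⊆p x∈Q)) (independent basisQ)
    Q⊆Q∩OPT∪x : Q ⊆ Q ∩ OPT ∪ ⁅ x ⁆
    Q⊆Q∩OPT∪x z∈Q with x∈p∪q⁻ OPT ⁅ x ⁆ (⊆A basisQ z∈Q)
    ... | inj₁ z∈OPT = p⊆p∪q ⁅ x ⁆ (x∈p∩q⁺ (z∈Q , z∈OPT))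
    ... | inj₂ z∈⁅x⁆ = q⊆p∪q (Q ∩ OPT) ⁅ x ⁆ z∈⁅x⁆
    Q∩OPT∪y≡OPT : Q ∩ OPT ∪ ⁅ y ⁆ ≡ OPT
    Q∩OPT∪y≡OPT = p⊆q∧∣q∣≤∣p∣⇒p≡q (∪-lub (p∩q⊆q Q OPT) (x∈p⇒⁅x⁆⊆p y∈OPT)) (begin
      ∣ OPT ∣                  ≤⟨ ∣∣≤rank independent-OPT (p⊆p∪q ⁅ x ⁆) ⟩
      rank M (OPT ∪ ⁅ x ⁆)     ≡⟨ ∣∣≡rank basisQ ⟨
      ∣ Q ∣                    ≤⟨ p⊆q⇒∣p∣≤∣q∣ Q⊆Q∩OPT∪x ⟩
      ∣ Q ∩ OPT ∪ ⁅ x ⁆ ∣      ≡⟨ ∣p∪⁅x⁆∣≡1+∣p∣ (x∉OPT ∘ p∩q⊆q Q OPT) ⟩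
      suc ∣ Q ∩ OPT ∣          ≡⟨ ∣p∪⁅x⁆∣≡1+∣p∣ y∉Q∩OPT ⟨
      ∣ Q ∩ OPT ∪ ⁅ y ⁆ ∣      ∎)

  IsUpperSet : Subset n → Set
  IsUpperSet Y = ∀ {y z} → y ∈ Y → z ∉ Y → w z ℚ.< w y

  rank≤∣OPT∩∣ : IsUpperSet Y → rank M Y ≤ ∣ OPT ∩ Y ∣
  rank≤∣OPT∩∣ {Y} upper =
    let P , basisP = basis Y
    in subst (_≤ ∣ OPT ∩ Y ∣) (∣∣≡rank basisP) (≮⇒≥ (no-augmentation basisP))
    where
    no-augmentation : ∀ {P} → IsBasis Y P → ¬ ∣ OPT ∩ Y ∣ < ∣ P ∣
    no-augmentation {P} basisP ∣OPT∩Y∣<∣P∣ =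
      let x , x∈P , x∉OPT∩Y , indOPT∩Y∪x =
            augment (independent-⊆ (p∩q⊆p OPT Y) independent-OPT) (independent basisP) ∣OPT∩Y∣<∣P∣
          x∈Y = ⊆A basisP x∈P
          y , y∈OPT , y∉OPT∩Y , wx<wy =
            swap-partner (p∩q⊆p OPT Y) (λ x∈OPT → x∉OPT∩Y (x∈p∩q⁺ (x∈OPT , x∈Y))) indOPT∩Y∪x
      in ℚP.<-asym wx<wy (upper x∈Y λ y∈Y → y∉OPT∩Y (x∈p∩q⁺ (y∈OPT , y∈Y)))

module Buckets {n : ℕ} (M : Matroid n) (w : Fin n → ℚ) {W : ℚ} (W-pos : 0ℚ ℚ.< W) {h : ℕ}
               (B : Bucketing h) where
  open import Data.Nat using (_≤_; _<_)
  open import Relation.Binary.Definitions using (tri<; tri≈; tri>)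
  open Algorithm M w W h B
  open Bucketing B
  open Subsets
  open Lists
  open Fractions

  private
    variable
      i j c : ℕ
      x : Fin n

  ℓ-mono-≤ : i ≤ j → j ≤ b → ℓ i ≤ ℓ j
  ℓ-mono-≤ {i} {zero}  z≤n _   = ≤-refl
  ℓ-mono-≤ {i} {suc j} i≤j j<b with m≤n⇒m<n∨m≡n i≤j
  ... | inj₂ refl = ≤-refl
  ... | inj₁ i<j  = ≤-trans (ℓ-mono-≤ (≤-pred i<j) (<⇒≤ j<b)) (<⇒≤ (ℓ-mono j j<b))

  b≤h : b ≤ h
  b≤h = subst (b ≤_) ℓ-last (j≤ℓj b ≤-refl)
    where
    j≤ℓj : ∀ j → j ≤ b → j ≤ ℓ j
    j≤ℓj zero    _   = z≤n
    j≤ℓj (suc j) j<b = ≤-<-trans (j≤ℓj j (<⇒≤ j<b)) (ℓ-mono j j<b)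

  fB-pred≤fB : ∀ i → i ≤ b → fB (i ∸ 1) ≤ fB i
  fB-pred≤fB zero          _   = z≤n
  fB-pred≤fB (suc zero)    _   = z≤n
  fB-pred≤fB (suc (suc i)) i<b = s≤s (<⇒≤ (ℓ-mono i (<⇒≤ i<b)))

  inC⇒bounds : inC c x ≡ true → c ≤ h × divPow2 W (suc (h ∸ c)) ℚ.< w x × w x ℚ.≤ divPow2 W (h ∸ c)
  inC⇒bounds {c} {x} x∈C =
    let _ , x∈C′ = ∧≡true⁻ ⌊ 1 ≤? c ⌋ x∈C
        c≤h , x∈C″ = ∧≡true⁻ ⌊ c ≤? h ⌋ x∈C′
        above , below = ∧≡true⁻ ⌊ divPow2 W (suc (h ∸ c)) ℚP.<? w x ⌋ x∈C″
    in ⌊⌋-sound (c ≤? h) c≤h ,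
       ⌊⌋-sound (divPow2 W (suc (h ∸ c)) ℚP.<? w x) above ,
       ⌊⌋-sound (w x ℚP.≤? divPow2 W (h ∸ c)) below

  inB⇒class : inB j x ≡ true → j ≤ b × ∃ λ c → fB j ≤ c × c ≤ ℓ j × inC c x ≡ true
  inB⇒class {j} {x} x∈B =
    let _ , x∈B′ = ∧≡true⁻ ⌊ 1 ≤? j ⌋ x∈B
        j≤b , x∈B″ = ∧≡true⁻ ⌊ j ≤? b ⌋ x∈B′
        c , c∈range , x∈C = anyᵇ⁻ {P = λ c → inC c x} (range (fB j) (ℓ j)) x∈B″
        fBj≤c , c≤ℓj = ∈-range⁻ c∈range
    in ⌊⌋-sound (j ≤? b) j≤b , c , fBj≤c , c≤ℓj , x∈C

  class⇒inB : 1 ≤ j → j ≤ b → fB j ≤ c → c ≤ ℓ j → inC c x ≡ true → inB j x ≡ true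
  class⇒inB {j} {c} {x} 1≤j j≤b fBj≤c c≤ℓj x∈C =
    ∧≡true⁺ (⌊⌋-complete (1 ≤? j) 1≤j)
      (∧≡true⁺ (⌊⌋-complete (j ≤? b) j≤b)
               (anyᵇ⁺ {P = λ c → inC c x} (range (fB j) (ℓ j)) (∈-range⁺ fBj≤c c≤ℓj) x∈C))

  threshold : ℕ → ℚ
  threshold i = divPow2 W (h ∸ ℓ i)

  light : inB i x ≡ true → w x ℚ.≤ threshold i
  light {i} {x} x∈Bi =
    let _ , c , _ , c≤ℓi , x∈C = inB⇒class {i} {x} x∈Bi
        _ , _ , below = inC⇒bounds {c} {x} x∈C
    in ℚP.≤-trans below (divPow2-anti W-pos (∸-monoʳ-≤ h c≤ℓi))

  heavy : i < j → inB j x ≡ true → threshold i ℚ.< w x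
  heavy {i} {suc j} {x} i<j x∈Bj =
    let j<b , c , ℓj<c , _ , x∈C = inB⇒class {suc j} {x} x∈Bj
        c≤h , above , _ = inC⇒bounds {c} {x} x∈C
        ℓi<c = ≤-<-trans (ℓ-mono-≤ (≤-pred i<j) (<⇒≤ j<b)) ℓj<c
    in ℚP.≤-<-trans (divPow2-anti W-pos (∸-monoʳ-< ℓi<c c≤h)) above

  heavy-above : inB≥ (suc i) x ≡ true → threshold i ℚ.< w x
  heavy-above {i} {x} x∈B≥ =
    let j , j∈range , x∈Bj = anyᵇ⁻ {P = λ j → inB j x} (range (suc i) b) x∈B≥
    in heavy {i} {j} {x} (proj₁ (∈-range⁻ j∈range)) x∈Bj

  bucket-unique : inB i x ≡ true → inB j x ≡ true → i ≡ j
  bucket-unique {i} {x} {j} x∈Bi x∈Bj with <-cmp i j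
  ... | tri< i<j _ _ = ⊥-elim (ℚP.<-irrefl refl (ℚP.<-≤-trans (heavy {i} {j} {x} i<j x∈Bj) (light {i} {x} x∈Bi)))
  ... | tri≈ _ i≡j _ = i≡j
  ... | tri> _ _ j<i = ⊥-elim (ℚP.<-irrefl refl (ℚP.<-≤-trans (heavy {j} {i} {x} j<i x∈Bi) (light {j} {x} x∈Bj)))

  bucketOf-inB : 1 ≤ i → inB i x ≡ true → bucketOf x ≡ i
  bucketOf-inB {i} {x} 1≤i x∈Bi = first-satisfying-unique (λ j → inB j x) (range 1 b)
    (∈-range⁺ 1≤i (proj₁ (inB⇒class {i} {x} x∈Bi))) x∈Bi
    (λ {j} x∈Bj → bucket-unique {j} {x} {i} x∈Bj x∈Bi)

  bucket-containing : ∀ k → j ≤ k → k ≤ b → fB j ≤ c → c ≤ ℓ k →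
                      ∃ λ k′ → j ≤ k′ × k′ ≤ b × fB k′ ≤ c × c ≤ ℓ k′
  bucket-containing zero    j≤0 0≤b _ c≤ℓ0 = zero , j≤0 , 0≤b , z≤n , c≤ℓ0
  bucket-containing {j} {c} (suc k) j≤1+k k<b fBj≤c c≤ℓ[1+k] with j ≤? k | c ≤? ℓ k
  ... | yes j≤k | yes c≤ℓk = bucket-containing k j≤k (<⇒≤ k<b) fBj≤c c≤ℓk
  ... | no  j≰k | _        =
    suc k , j≤1+k , k<b , subst (λ j → fB j ≤ c) (≤-antisym j≤1+k (≰⇒> j≰k)) fBj≤c , c≤ℓ[1+k]
  ... | yes _   | no c≰ℓk  = suc k , j≤1+k , k<b , ≰⇒> c≰ℓk , c≤ℓ[1+k]

  C≥⊆B≥ : 1 ≤ j → j ≤ b → C≥ (fB j) ⊆ B≥ j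
  C≥⊆B≥ {j} 1≤j j≤b {x} x∈C≥ =
    let c , c∈range , x∈C = anyᵇ⁻ {P = λ c → inC c x} (range (fB j) h) (∈-setOf⁻ {P = inC≥ (fB j)} x∈C≥)
        fBj≤c , c≤h = ∈-range⁻ c∈range
        k , j≤k , k≤b , fBk≤c , c≤ℓk =
          bucket-containing b j≤b ≤-refl fBj≤c (subst (c ≤_) (sym ℓ-last) c≤h)
    in ∈-setOf⁺ {P = inB≥ j} (anyᵇ⁺ {P = λ k → inB k x} (range j b) (∈-range⁺ j≤k k≤b)
         (class⇒inB {k} {c} {x} (≤-trans 1≤j j≤k) k≤b fBk≤c c≤ℓk x∈C))

  C≥-anti : c ≤ j → C≥ j ⊆ C≥ c
  C≥-anti {c} {j} c≤j {x} x∈C≥j =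
    let k , k∈range , x∈Ck = anyᵇ⁻ {P = λ k → inC k x} (range j h) (∈-setOf⁻ {P = inC≥ j} x∈C≥j)
        j≤k , k≤h = ∈-range⁻ k∈range
    in ∈-setOf⁺ {P = inC≥ c}
         (anyᵇ⁺ {P = λ k → inC k x} (range c h) (∈-range⁺ (≤-trans c≤j j≤k) k≤h) x∈Ck)

module OnlineGreedy {n : ℕ} (M : Matroid n) (w : Fin n → ℚ) {W : ℚ} (W-pos : 0ℚ ℚ.< W) {h : ℕ}
                    (B : Bucketing h) (S : Subset n) (odd : Bool) {i : ℕ} (1≤i : 1 ℕ.≤ i) where
  open import Data.Nat using (_≤_; _<_)
  open import Function.Bundles using (Equivalence)
  open Algorithm M w W h B
  open MatroidRank M
  open Buckets M w W-pos B
  open Subsets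

  private
    variable
      I J : Subset n

  X : Subset n
  X = S ∩ B≥ (suc i)

  record Independentᵢ (I : Subset n) : Set where
    field
      ⊆ground    : I ⊆ groundM S i
      disjoint   : Disjoint I X
      contracted : Independent/ X I

  open Independentᵢ

  indepM⇒Independentᵢ : indepM S i I ≡ true → Independentᵢ I
  indepM⇒Independentᵢ {I} I∈ =
    let I⊆N , I∈′ = ∧≡true⁻ (I ⊆ᵇ groundM S i) I∈
        I#X , rank≡ = ∧≡true⁻ ⌊ ∣ I ∩ X ∣ ≟ 0 ⌋ I∈′
    in record { ⊆ground    = ⊆ᵇ⇒⊆ I⊆N
              ; disjoint   = ∣p∩q∣≡0⇒Disjoint (⌊⌋-sound (∣ I ∩ X ∣ ≟ 0) I#X)
              ; contracted = ≤-reflexive (sym (⌊⌋-sound (rank M (I ∪ X) ≟ ∣ I ∣ + rank M X) rank≡)) }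

  Independentᵢ⇒indepM : Independentᵢ I → indepM S i I ≡ true
  Independentᵢ⇒indepM {I} indI =
    ∧≡true⁺ (⊆⇒⊆ᵇ (⊆ground indI))
      (∧≡true⁺ (⌊⌋-complete (∣ I ∩ X ∣ ≟ 0)
                              (trans (cong ∣_∣ (Disjoint⇒p∩q≡⊥ (disjoint indI))) (∣⊥∣≡0 n)))
               (⌊⌋-complete (rank M (I ∪ X) ≟ ∣ I ∣ + rank M X) (independent/⇒rank≡ (contracted indI))))

  Independentᵢ-⊆ : J ⊆ I → Independentᵢ I → Independentᵢ J
  Independentᵢ-⊆ J⊆I indI = record
    { ⊆ground    = ⊆-trans J⊆I (⊆ground indI)
    ; disjoint   = disjoint indI ∘ J⊆I
    ; contracted = independent/-⊆ J⊆I (contracted indI) }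

  Independentᵢ-⊥ : Independentᵢ ⊥
  Independentᵢ-⊥ = record
    { ⊆ground    = ⊥⊆
    ; disjoint   = λ x∈⊥ → contradiction x∈⊥ ∉⊥
    ; contracted = independent/-⊥ }

  groundM⊆Bset : ∀ j → 1 ≤ j → groundM S j ⊆ Bset j
  groundM⊆Bset (suc zero)    _ = ⊆-refl
  groundM⊆Bset (suc (suc j)) _ = p∩q⊆p (Bset (suc (suc j))) _

  bucketOf-Bᵢ : ∀ {e} → e ∈ Bset i → bucketOf e ≡ i
  bucketOf-Bᵢ e∈Bᵢ = bucketOf-inB 1≤i (∈-setOf⁻ {P = inB i} e∈Bᵢ)

  accepts-in : ℕ → Subset n → Fin n → Bool
  accepts-in j T e = inH odd j ∧ (e ∈ᵇ groundM S j) ∧ indepM S j ((T ∩ Bset j) ∪ ⁅ e ⁆)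

  accepts : Subset n → Fin n → Bool
  accepts T e = accepts-in (bucketOf e) T e

  accepts-Bᵢ : ∀ {T e} → e ∈ Bset i → accepts T e ≡ accepts-in i T e
  accepts-Bᵢ {T} {e} e∈Bᵢ = cong (λ j → accepts-in j T e) (bucketOf-Bᵢ e∈Bᵢ)

  StepCase : Subset n → Fin n → Set
  StepCase T e = accepts T e ≡ true × step S odd T e ≡ T ∪ ⁅ e ⁆ ⊎ accepts T e ≡ false × step S odd T e ≡ T

  -- Case analyses on the acceptance test go through step-cases: a with-abstraction over it would
  -- normalise the rank computations inside accepts.
  step-cases : ∀ T e → StepCase T e
  step-cases T e = if-cases (accepts T e)

  step-⊇ : ∀ T e → T ⊆ step S odd T e
  step-⊇ T e = by-cases (step-cases T e)
    where
    by-cases : StepCase T e → T ⊆ step S odd T e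
    by-cases (inj₁ (_ , added)) = subst (T ⊆_) (sym added) (p⊆p∪q ⁅ e ⁆)
    by-cases (inj₂ (_ , kept))  = subst (T ⊆_) (sym kept) ⊆-refl

  step-preserves : ∀ T e → Independentᵢ (T ∩ Bset i) → Independentᵢ (step S odd T e ∩ Bset i)
  step-preserves T e indT = by-cases (step-cases T e)
    where
    accepted-in-bucket : accepts T e ≡ true → Dec (e ∈ Bset i) → Independentᵢ ((T ∪ ⁅ e ⁆) ∩ Bset i)
    accepted-in-bucket acc (yes e∈Bᵢ) =
      let _ , acc′ = ∧≡true⁻ (inH odd i) (trans (sym (accepts-Bᵢ {T} {e} e∈Bᵢ)) acc)
          _ , T∩Bᵢ∪e∈ℐᵢ = ∧≡true⁻ (e ∈ᵇ groundM S i) acc′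
      in Independentᵢ-⊆ ([p∪⁅x⁆]∩q⊆p∩q∪⁅x⁆ T (Bset i) e) (indepM⇒Independentᵢ T∩Bᵢ∪e∈ℐᵢ)
    accepted-in-bucket _ (no e∉Bᵢ) = Independentᵢ-⊆ (x∉q⇒[p∪⁅x⁆]∩q⊆p∩q T (Bset i) e∉Bᵢ) indT
    by-cases : StepCase T e → Independentᵢ (step S odd T e ∩ Bset i)
    by-cases (inj₁ (acc , added)) =
      subst (λ U → Independentᵢ (U ∩ Bset i)) (sym added) (accepted-in-bucket acc (e ∈? Bset i))
    by-cases (inj₂ (_ , kept)) = subst (λ U → Independentᵢ (U ∩ Bset i)) (sym kept) indT

  foldl-⊇ : ∀ xs T → T ⊆ foldl (step S odd) T xs
  foldl-⊇ []       T = ⊆-refl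
  foldl-⊇ (x ∷ xs) T = ⊆-trans (step-⊇ T x) (foldl-⊇ xs (step S odd T x))

  foldl-preserves : ∀ xs T → Independentᵢ (T ∩ Bset i) → Independentᵢ (foldl (step S odd) T xs ∩ Bset i)
  foldl-preserves []       T indT = indT
  foldl-preserves (x ∷ xs) T indT = foldl-preserves xs (step S odd T x) (step-preserves T x indT)

  foldl-maximal : ∀ xs T {e} → e ∈ˡ xs → e ∈ Bset i → inH odd i ≡ true → e ∈ groundM S i →
                  e ∈ foldl (step S odd) T xs ⊎ ¬ Independentᵢ (foldl (step S odd) T xs ∩ Bset i ∪ ⁅ e ⁆)
  foldl-maximal (x ∷ xs) T (there e∈xs) = foldl-maximal xs (step S odd T x) e∈xs
  foldl-maximal (e ∷ xs) T (here refl) e∈Bᵢ i∈H e∈N = by-cases (step-cases T e)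
    where
    F : Subset n
    F = foldl (step S odd) (step S odd T e) xs
    would-accept : Independentᵢ (F ∩ Bset i ∪ ⁅ e ⁆) → T ⊆ F → accepts T e ≡ true
    would-accept indF T⊆F = trans (accepts-Bᵢ {T} {e} e∈Bᵢ) (∧≡true⁺ i∈H (∧≡true⁺ (∈⇒∈ᵇ e∈N)
      (Independentᵢ⇒indepM (Independentᵢ-⊆ (p⊆r⇒p∩q∪⁅x⁆⊆r∩q∪⁅x⁆ (Bset i) e T⊆F) indF))))
    by-cases : StepCase T e → e ∈ F ⊎ ¬ Independentᵢ (F ∩ Bset i ∪ ⁅ e ⁆)
    by-cases (inj₁ (_ , added))  =
      inj₁ (foldl-⊇ xs (step S odd T e) (subst (e ∈_) (sym added) (x∈p∪⁅x⁆ T e)))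
    by-cases (inj₂ (rej , kept)) = inj₂ λ indF →
      contradiction (trans (sym rej) (would-accept indF (subst (_⊆ F) kept (foldl-⊇ xs (step S odd T e))))) λ ()

  run-lower-bound : ∀ {ord} → IsRevealOrder ord → inH odd i ≡ true →
                    J ⊆ groundM S i → Disjoint J S → Independent/ X J →
                    ∣ J ∣ ≤ ∣ run S odd (ord S) ∩ Bset i ∣
  run-lower-bound {J} {ord} reveal i∈H J⊆N J#S indJ = ≮⇒≥ λ ∣T∣<∣J∣ →
    let x , x∈J , x∉T , indT∪x = independent/-augment (contracted indT) indJ ∣T∣<∣J∣
    in x∉T (no-augmentation x∈J indT∪x)
    where
    Tᵢ : Subset n
    Tᵢ = run S odd (ord S) ∩ Bset i
    indT : Independentᵢ Tᵢ
    indT = foldl-preserves (ord S) ⊥ (Independentᵢ-⊆ (p∩q⊆p ⊥ (Bset i)) Independentᵢ-⊥)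
    no-augmentation : ∀ {x} → x ∈ J → Independent/ X (Tᵢ ∪ ⁅ x ⁆) → x ∈ Tᵢ
    no-augmentation {x} x∈J indT∪x = by-cases (foldl-maximal (ord S) ⊥ x∈ord x∈Bᵢ i∈H (J⊆N x∈J))
      where
      x∈Bᵢ : x ∈ Bset i
      x∈Bᵢ = groundM⊆Bset i 1≤i (J⊆N x∈J)
      x∈ord : x ∈ˡ ord S
      x∈ord = Equivalence.from (proj₂ (reveal S) x) (∉⇒∈ᵇ≡false (J#S x∈J))
      x∉X : x ∉ X
      x∉X x∈X = J#S x∈J (p∩q⊆p S (B≥ (suc i)) x∈X)
      indᵢT∪x : Independentᵢ (Tᵢ ∪ ⁅ x ⁆)
      indᵢT∪x = record
        { ⊆ground    = ∪-lub (⊆ground indT) (x∈p⇒⁅x⁆⊆p (J⊆N x∈J))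
        ; disjoint   = Disjoint-∪⁅x⁆ (disjoint indT) x∉X
        ; contracted = indT∪x }
      by-cases : x ∈ run S odd (ord S) ⊎ ¬ Independentᵢ (Tᵢ ∪ ⁅ x ⁆) → x ∈ Tᵢ
      by-cases (inj₁ x∈run) = x∈p∩q⁺ (x∈run , x∈Bᵢ)
      by-cases (inj₂ ¬ind)  = contradiction indᵢT∪x ¬ind

module Probabilities {n : ℕ} (M : Matroid n) (w : Fin n → ℚ) {W : ℚ} (W-pos : 0ℚ ℚ.< W) {h : ℕ}
                     (B : Bucketing h) where
  open import Data.Nat using (_≤_; _<_; _*_; NonZero)
  open import Data.Integer using (+_)
  open import Data.Rational using (_/_)
  open Algorithm M w W h B
  open Bucketing B using (b)
  open MatroidRank M using (inSpan-mono)
  open Buckets M w W-pos B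
  open Subsets
  open Lists
  open Counting
  open Fractions

  private instance
    2^n≢0 : NonZero (2 ^ n)
    2^n≢0 = m^n≢0 2 n

  Event : ℕ → Fin n → Subset n → Bool
  Event zero    e S = not (e ∈ᵇ S)
  Event (suc k) e S = not (e ∈ᵇ S) ∧ inSpan M (S ∩ C≥ (suc k)) e

  p≡ : ∀ e k → p e k ≡ + (2 * count (Event k e) (allSubsets n)) / 2 ^ n
  p≡ e zero    = sym (trans (cong (λ c → + c / 2 ^ n) (2*count-∉ e)) (n/n≡1 (2 ^ n)))
  p≡ e (suc k) = refl

  Event⇒∉ : ∀ k {e S} → Event k e S ≡ true → e ∉ S
  Event⇒∉ zero    e∉S e∈S = contradiction (trans (sym e∉S) (cong not (∈⇒∈ᵇ e∈S))) λ ()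
  Event⇒∉ (suc k) {e} {S} ev = Event⇒∉ zero (proj₁ (∧≡true⁻ (not (e ∈ᵇ S)) ev))

  Event-anti : ∀ {k k′ e S} → k ≤ k′ → Event k′ e S ≡ true → Event k e S ≡ true
  Event-anti {zero}  {zero}            _    ev = ev
  Event-anti {zero}  {suc k′} {e} {S}  _    ev = proj₁ (∧≡true⁻ (not (e ∈ᵇ S)) ev)
  Event-anti {suc k} {suc k′} {e} {S} k≤k′ ev =
    let e∉S , e∈span = ∧≡true⁻ (not (e ∈ᵇ S)) ev
    in ∧≡true⁺ e∉S (inSpan-mono (∩-monoʳ-⊆ S (C≥-anti k≤k′)) e∈span)

  p-anti : ∀ {k k′} e → k ≤ k′ → p e k′ ℚ.≤ p e k
  p-anti {k} {k′} e k≤k′ = subst₂ ℚ._≤_ (sym (p≡ e k′)) (sym (p≡ e k))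
    (/-monoˡ-≤ (2 ^ n) (*-monoʳ-≤ 2 (count-mono (allSubsets n) λ S → Event-anti {k} {k′} {e} {S} k≤k′)))

  Event⇒ground : ∀ i → 1 ≤ i → i ≤ b → ∀ {e S} →
                 inB i e ≡ true → Event (fB (i ∸ 1)) e S ≡ true → e ∈ groundM S i
  Event⇒ground (suc zero)    _ _   e∈B _ = ∈-setOf⁺ {P = inB 1} e∈B
  Event⇒ground (suc (suc m)) _ i≤b {e} {S} e∈B ev =
    x∈p∩q⁺ (∈-setOf⁺ {P = inB (suc (suc m))} e∈B , ∈-setOf⁺ {P = inSpan M (S ∩ B≥ (suc m))} e∈span)
    where
    e∈span : inSpan M (S ∩ B≥ (suc m)) e ≡ true
    e∈span = inSpan-mono (∩-monoʳ-⊆ S (C≥⊆B≥ (s≤s z≤n) (<⇒≤ i≤b)))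
                         (proj₂ (∧≡true⁻ (not (e ∈ᵇ S)) ev))

module BucketGuarantee {n : ℕ} (M : Matroid n) (w : Fin n → ℚ) (w-pos : ∀ x → 0ℚ ℚ.< w x)
                       (OPT : Subset n) (opt : IsUniqueMaxWeightBasis M w OPT)
                       {W : ℚ} (W-pos : 0ℚ ℚ.< W) {h : ℕ} (B : Bucketing h)
                       {ord : Subset n → List (Fin n)} (reveal : Algorithm.IsRevealOrder M w W h B ord)
                       {i : ℕ} (1≤i : 1 ℕ.≤ i) (i≤b : i ℕ.≤ Bucketing.b B) where
  open import Data.Nat using (_≤_; _<_; _*_; NonZero)
  open import Data.Integer using (+_)
  open import Data.Rational using (_/_)
  open import Data.List.Properties using (map-cong)
  open Algorithm M w W h B
  open MatroidRank M
  open MaxWeightBasis M w w-pos OPT opt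
  open Buckets M w W-pos B
  open Probabilities M w W-pos B
  open Subsets
  open Lists
  open Counting
  open Fractions

  private instance
    2^n≢0 : NonZero (2 ^ n)
    2^n≢0 = m^n≢0 2 n
    2^1+n≢0 : NonZero (2 ^ suc n)
    2^1+n≢0 = m^n≢0 2 (suc n)

  isHeavy : Fin n → Bool
  isHeavy x = ⌊ threshold i ℚP.<? w x ⌋

  Heavy : Subset n
  Heavy = setOf isHeavy

  ∈Heavy⁺ : ∀ {x} → threshold i ℚ.< w x → x ∈ Heavy
  ∈Heavy⁺ {x} = ∈-setOf⁺ {P = isHeavy} ∘ ⌊⌋-complete (threshold i ℚP.<? w x)

  ∈Heavy⁻ : ∀ {x} → x ∈ Heavy → threshold i ℚ.< w x
  ∈Heavy⁻ {x} = ⌊⌋-sound (threshold i ℚP.<? w x) ∘ ∈-setOf⁻ {P = isHeavy}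

  Heavy-upper : IsUpperSet Heavy
  Heavy-upper y∈Heavy z∉Heavy = ℚP.≤-<-trans (ℚP.≮⇒≥ (z∉Heavy ∘ ∈Heavy⁺)) (∈Heavy⁻ y∈Heavy)

  above⊆Heavy : ∀ S → S ∩ B≥ (suc i) ⊆ Heavy
  above⊆Heavy S x∈ = ∈Heavy⁺ (heavy-above (∈-setOf⁻ {P = inB≥ (suc i)} (p∩q⊆q S (B≥ (suc i)) x∈)))

  Bᵢ∌Heavy : ∀ {x} → inB i x ≡ true → x ∉ Heavy
  Bᵢ∌Heavy x∈Bᵢ x∈Heavy = ℚP.<-irrefl refl (ℚP.<-≤-trans (∈Heavy⁻ x∈Heavy) (light x∈Bᵢ))

  InJ : ℕ → Fin n → Subset n → Bool
  InJ k e S = (inB i e ∧ (e ∈ᵇ OPT)) ∧ Event k e S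

  J : Subset n → Subset n
  J S = setOf (λ e → InJ (fB (i ∸ 1)) e S)

  ∈J⁻ : ∀ {S e} → e ∈ J S → inB i e ≡ true × e ∈ OPT × Event (fB (i ∸ 1)) e S ≡ true
  ∈J⁻ {S} {e} e∈ =
    let e∈Bᵢ∩OPT , ev =
          ∧≡true⁻ (inB i e ∧ (e ∈ᵇ OPT)) (∈-setOf⁻ {P = λ e → InJ (fB (i ∸ 1)) e S} e∈)
        e∈Bᵢ , e∈OPT = ∧≡true⁻ (inB i e) e∈Bᵢ∩OPT
    in e∈Bᵢ , ∈ᵇ⇒∈ e∈OPT , ev

  J-independent/ : ∀ S → Independent/ (S ∩ B≥ (suc i)) (J S)
  J-independent/ S = independent/-antitone (above⊆Heavy S)
    (independent/-outside independent-OPT (proj₁ ∘ proj₂ ∘ ∈J⁻) (Bᵢ∌Heavy ∘ proj₁ ∘ ∈J⁻)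
                          (rank≤∣OPT∩∣ Heavy-upper))

  ∣J∣≤ : ∀ S → ∣ J S ∣ ≤ ∣ run S true (ord S) ∩ Bset i ∣ + ∣ run S false (ord S) ∩ Bset i ∣
  ∣J∣≤ S = by-parity (parity ⌊ 1 ≤? i ⌋ ⌊ i ≤? h ⌋ _ (⌊⌋-complete (1 ≤? i) 1≤i)
                                                     (⌊⌋-complete (i ≤? h) (≤-trans i≤b b≤h)))
    where
    parity : ∀ a b c → a ≡ true → b ≡ true → a ∧ b ∧ c ≡ true ⊎ a ∧ b ∧ not c ≡ true
    parity _ _ true  refl refl = inj₁ refl
    parity _ _ false refl refl = inj₂ refl
    bound : ∀ odd → inH odd i ≡ true → ∣ J S ∣ ≤ ∣ run S odd (ord S) ∩ Bset i ∣
    bound odd i∈H = OnlineGreedy.run-lower-bound M w W-pos B S odd 1≤i reveal i∈H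
      (λ e∈ → let e∈Bᵢ , _ , ev = ∈J⁻ e∈ in Event⇒ground i 1≤i i≤b e∈Bᵢ ev)
      (Event⇒∉ (fB (i ∸ 1)) ∘ proj₂ ∘ proj₂ ∘ ∈J⁻)
      (J-independent/ S)
    by-parity : inH true i ≡ true ⊎ inH false i ≡ true →
                ∣ J S ∣ ≤ ∣ run S true (ord S) ∩ Bset i ∣ + ∣ run S false (ord S) ∩ Bset i ∣
    by-parity (inj₁ i∈Hodd)  = ≤-trans (bound true i∈Hodd) (m≤m+n _ _)
    by-parity (inj₂ i∈Heven) = ≤-trans (bound false i∈Heven) (m≤n+m _ _)

  sumP≡ : ∀ k →
          sumP OPT i k ≡ + (2 * sum (map (λ S → ∣ setOf (λ e → InJ k e S) ∣) (allSubsets n))) / 2 ^ n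
  sumP≡ k = begin
    sumℚ (map (λ e → if inBᵢ∩OPT e then p e k else 0ℚ) (allFin n))
      ≡⟨ cong sumℚ (map-cong (λ e → pointwise (inBᵢ∩OPT e) e) (allFin n)) ⟩
    sumℚ (map (λ e → + (2 * N e) / 2 ^ n) (allFin n))
      ≡⟨ sumℚ-map-/ (λ e → 2 * N e) (2 ^ n) (allFin n) ⟩
    + sum (map (λ e → 2 * N e) (allFin n)) / 2 ^ n
      ≡⟨ cong (λ c → + c / 2 ^ n) (trans (sum-map-*ˡ 2 N (allFin n)) (cong (2 *_) double-count)) ⟩
    + (2 * sum (map (λ S → ∣ setOf (λ e → InJ k e S) ∣) (allSubsets n))) / 2 ^ n
      ∎
    where
    open ≡-Reasoning
    inBᵢ∩OPT : Fin n → Bool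
    inBᵢ∩OPT e = inB i e ∧ (e ∈ᵇ OPT)
    N : Fin n → ℕ
    N e = if inBᵢ∩OPT e then count (Event k e) (allSubsets n) else 0
    pointwise : ∀ c e → (if c then p e k else 0ℚ) ≡
                        + (2 * (if c then count (Event k e) (allSubsets n) else 0)) / 2 ^ n
    pointwise true  e = p≡ e k
    pointwise false e = sym (ℚP.0/n≡0 (2 ^ n))
    double-count : sum (map N (allFin n)) ≡ sum (map (λ S → ∣ setOf (λ e → InJ k e S) ∣) (allSubsets n))
    double-count = begin
      sum (map N (allFin n))
        ≡⟨ cong sum (map-cong (λ e → count-∧ (inBᵢ∩OPT e) (Event k e) (allSubsets n)) (allFin n)) ⟨
      sum (map (λ e → count (InJ k e) (allSubsets n)) (allFin n))
        ≡⟨ sum-∣setOf∣≡sum-count (InJ k) (allSubsets n) ⟨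
      sum (map (λ S → ∣ setOf (λ e → InJ k e S) ∣) (allSubsets n))
        ∎

  ¼sumP≤expectedTB : (+ 1 / 4) ℚ.* sumP OPT i (fB (i ∸ 1)) ℚ.≤ expectedTB ord i
  ¼sumP≤expectedTB = begin
    (+ 1 / 4) ℚ.* sumP OPT i (fB (i ∸ 1))     ≡⟨ cong ((+ 1 / 4) ℚ.*_) (sumP≡ (fB (i ∸ 1))) ⟩
    (+ 1 / 4) ℚ.* (+ (2 * ∑∣J∣) / 2 ^ n)    ≡⟨ ¼*2a/d≡a/2d ∑∣J∣ (2 ^ n) ⟩
    + ∑∣J∣ / 2 ^ suc n                       ≤⟨ /-monoˡ-≤ (2 ^ suc n) ∑∣J∣≤ ⟩
    expectedTB ord i                            ∎
    where
    open ℚP.≤-Reasoning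
    ∑∣J∣ : ℕ
    ∑∣J∣ = sum (map (λ S → ∣ J S ∣) (allSubsets n))
    ∑∣J∣≤ : ∑∣J∣ ≤ sum (map (λ S → ∣ run S true (ord S) ∩ Bset i ∣ + ∣ run S false (ord S) ∩ Bset i ∣)
                                   (allSubsets n))
    ∑∣J∣≤ = sum-map-mono (allSubsets n) ∣J∣≤

  ¼sumP-anti : (+ 1 / 4) ℚ.* sumP OPT i (fB i) ℚ.≤ (+ 1 / 4) ℚ.* sumP OPT i (fB (i ∸ 1))
  ¼sumP-anti = ℚP.*-monoˡ-≤-nonNeg (+ 1 / 4)
    (sumℚ-map-mono (allFin n) λ e → if-≤ (inB i e ∧ (e ∈ᵇ OPT)) (p-anti e (fB-pred≤fB i i≤b)))

open import Data.Integer using (+_)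
open import Data.Rational using (_<_; _≤_; _*_; _/_)
open import Function.Definitions using (Injective)

lemma4 : {n : ℕ} (M : Matroid n) (w : Fin n → ℚ) →
         (∀ e → 0ℚ < w e) → Injective _≡_ _≡_ w →
         (OPT : Subset n) → IsUniqueMaxWeightBasis M w OPT →
         (ρ W : ℚ) → 1ℚ ≤ ρ → 0ℚ < W →
         (h : ℕ) → IsCeilLog ρ h →
         (B : Bucketing h) →
         (ord : Subset n → List (Fin n)) → Algorithm.IsRevealOrder M w W h B ord →
         (i : ℕ) → 1 ℕ.≤ i → i ℕ.≤ Bucketing.b B →
         ((+ 1 / 4) * Algorithm.sumP M w W h B OPT i (Algorithm.fB M w W h B (i ℕ.∸ 1))
            ≤ Algorithm.expectedTB M w W h B ord i)
         × ((+ 1 / 4) * Algorithm.sumP M w W h B OPT i (Algorithm.fB M w W h B i)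
            ≤ (+ 1 / 4) * Algorithm.sumP M w W h B OPT i (Algorithm.fB M w W h B (i ℕ.∸ 1)))
lemma4 M w w-pos _ OPT opt _ _ _ W-pos _ _ B _ reveal _ 1≤i i≤b = ¼sumP≤expectedTB , ¼sumP-anti
  where open BucketGuarantee M w w-pos OPT opt W-pos B reveal 1≤i i≤b
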